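{- Let $G$ be a graph belonging to an association scheme. If the Grover walk on $G$ exhibits perfect state transfer, and $\tau$ is the minimum positive integer at which perfect state transfer occurs on $G$, then $G$ is $2\tau$-periodic.
   Context: Grover walk: let $G$ be a finite simple graph without isolated vertices. Its symmetric arc set is $\mathcal{A}(G)=\{(u,v),(v,u):uv\in E(G)\}$; for $a=(u,v)$, $t(a)=v$, $a^{ -1}=(v,u)$. Shift matrix $S_{ab}=\delta_{a,b^{ -1}}$; boundary matrix $N\in\mathbb{C}^{V(G)\times\mathcal{A}(G)}$, $N_{ua}=\frac{1}{\sqrt{\deg u}}\delta_{u,t(a)}$; coin $K=2N^*N-I$; time evolution matrix $U=SK$. For a vertex $u$ let $\Phi_u=N^*\mathbf{e}_u$. $G$ exhibits perfect state transfer from $u$ to a vertex $v\neq u$ at time $\tau\in\mathbb{N}$ if $U^\tau\Phi_u=\gamma\Phi_v$ for some unimodular $\gamma\in\mathbb{C}$. $G$ is $\tau$-periodic if $\tau$ is the smallest positive integer with $U^\tau=I$. Association scheme with $d$ classes: a set $\{A_0,\dots,A_d\}$ of $n\times n$ $(0,1)$-matrices with $A_0=I$, $\sum_iA_i=J$, each $A_i$ symmetric, and each $A_iA_j$ a linear combination of $A_0,\dots,A_d$. A graph belongs to the scheme if its adjacency matrix lies in the span of $A_0,\dots,A_d$. -}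

module Defs where

open import Data.Nat as ℕ using (ℕ; zero; suc; _≤_; _<_)
open import Data.Fin as F using (Fin)
open import Data.Bool using (Bool; true; false; if_then_else_; _∧_; T)
open import Data.Product using (_×_; _,_; proj₁; proj₂; Σ; ∃)
open import Data.Integer using (+_)
open import Data.Rational using (ℚ; 0ℚ; 1ℚ; _+_; _*_; _-_; _/_)
open import Relation.Nullary using (¬_)
open import Relation.Nullary.Decidable using (⌊_⌋)
open import Relation.Binary.PropositionalEquality using (_≡_; _≢_)

ΣF : (n : ℕ) → (Fin n → ℚ) → ℚ
ΣF zero    f = 0ℚ
ΣF (suc n) f = f F.zero + ΣF n (λ i → f (F.suc i))

ΣFℕ : (n : ℕ) → (Fin n → ℕ) → ℕ
ΣFℕ zero    f = 0
ΣFℕ (suc n) f = f F.zero ℕ.+ ΣFℕ n (λ i → f (F.suc i))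

b2ℚ : Bool → ℚ
b2ℚ b = if b then 1ℚ else 0ℚ

b2ℕ : Bool → ℕ
b2ℕ b = if b then 1 else 0

_==_ : ∀ {n} → Fin n → Fin n → Bool
x == y = ⌊ x F.≟ y ⌋

record Graph (n : ℕ) : Set where
  field
    adj       : Fin n → Fin n → Bool
    symmetric : ∀ u v → adj u v ≡ adj v u
    loopless  : ∀ u → adj u u ≡ false

module _ {n : ℕ} (G : Graph n) where
  open Graph G

  deg : Fin n → ℕ
  deg u = ΣFℕ n (λ v → b2ℕ (adj u v))

  NoIsolated : Set
  NoIsolated = ∀ u → deg u ≢ 0

  Pair : Set
  Pair = Fin n × Fin n

  isArc : Pair → Bool
  isArc (u , v) = adj u v

  IsArc : Pair → Set
  IsArc a = T (isArc a)

  tgt : Pair → Fin n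
  tgt = proj₂

  inv : Pair → Pair
  inv (u , v) = (v , u)

  eqP : Pair → Pair → Bool
  eqP (u , v) (u' , v') = (u == u') ∧ (v == v')

  -- matrices / vectors indexed by arcs (entries at non-arcs are 0)
  Mat : Set
  Mat = Pair → Pair → ℚ

  VecA : Set
  VecA = Pair → ℚ

  ΣA : (Pair → ℚ) → ℚ
  ΣA f = ΣF n (λ u → ΣF n (λ v → b2ℚ (isArc (u , v)) * f (u , v)))

  _·_ : Mat → Mat → Mat
  (M · M') a b = ΣA (λ c → M a c * M' c b)

  _▷_ : Mat → VecA → VecA
  (M ▷ x) a = ΣA (λ c → M a c * x c)

  idA : Mat
  idA a b = b2ℚ (isArc a ∧ isArc b ∧ eqP a b)

  -- 1 / d as a rational (d = 0 never occurs for graphs without isolated vertices)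
  recip : ℕ → ℚ
  recip zero    = 0ℚ
  recip (suc k) = (+ 1) / suc k

  S : Mat
  S a b = b2ℚ (isArc a ∧ isArc b ∧ eqP a (inv b))

  -- (N* N)_{ab} = Σ_w N_{wa} N_{wb} = δ_{t(a),t(b)} / deg t(a)
  NstarN : Mat
  NstarN a b = b2ℚ (isArc a ∧ isArc b ∧ (tgt a == tgt b)) * recip (deg (tgt a))

  K : Mat
  K a b = ((+ 2) / 1) * NstarN a b - idA a b

  U : Mat
  U = S · K

  _^_ : Mat → ℕ → Mat
  M ^ zero  = idA
  M ^ suc k = M · (M ^ k)

  -- χ_u = √(deg u) · Φ_u, indicator of arcs with terminal vertex u
  χ : Fin n → VecA
  χ u a = b2ℚ (isArc a ∧ (tgt a == u))

  -- Perfect state transfer u → v at time τ:  U^τ Φ_u = γ Φ_v, |γ| = 1.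
  -- Rephrased with Φ_u = χ_u / √deg u: U^τ χ_u = c χ_v with c = γ √(deg u / deg v);
  -- since U is rational, c is necessarily rational.
  PST : Fin n → Fin n → ℕ → Set
  PST u v τ = (u ≢ v) × ∃ λ (c : ℚ) →
      (c * c * ((+ deg v) / 1) ≡ (+ deg u) / 1)
    × (∀ a → IsArc a → ((U ^ τ) ▷ χ u) a ≡ c * χ v a)

  HasPSTAt : ℕ → Set
  HasPSTAt τ = ∃ λ u → ∃ λ v → PST u v τ

  IsIdentity : Mat → Set
  IsIdentity M = ∀ a b → IsArc a → IsArc b → M a b ≡ idA a b

  Periodic : ℕ → Set
  Periodic τ = (1 ≤ τ) × IsIdentity (U ^ τ)
             × (∀ k → 1 ≤ k → k < τ → ¬ IsIdentity (U ^ k))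

record AssocScheme (n d : ℕ) : Set where
  field
    A        : Fin (suc d) → Fin n → Fin n → Bool
    A₀-id    : ∀ x y → A F.zero x y ≡ (x == y)
    sum-J    : ∀ x y → ΣFℕ (suc d) (λ i → b2ℕ (A i x y)) ≡ 1
    A-sym    : ∀ i x y → A i x y ≡ A i y x
    closed   : ∀ i j → ∃ λ (p : Fin (suc d) → ℚ) → ∀ x y →
                 ΣF n (λ z → b2ℚ (A i x z) * b2ℚ (A j z y))
                   ≡ ΣF (suc d) (λ k → p k * b2ℚ (A k x y))

BelongsTo : ∀ {n d} → Graph n → AssocScheme n d → Set
BelongsTo {n} {d} G 𝒜 = ∃ λ (c : Fin (suc d) → ℚ) → ∀ x y →
  b2ℚ (Graph.adj G x y) ≡ ΣF (suc d) (λ k → c k * b2ℚ (AssocScheme.A 𝒜 k x y))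

-- Graphs in an association scheme are regular (row sums of Bose–Mesner matrices are constant),
-- say of degree k, and on arc vectors U x (a) = (2/k) Σ_{t(b) = o(a)} x b − x (a⁻¹); U is
-- orthogonal, being the permutation S times the reflection K = 2 N*N − I. With χ w = √k Φ_w,
-- every U^t χ w has the form α (t a) + β (o a) with α, β columns of Bose–Mesner matrices, so
-- M y w = ⟪ χ y , U^τ χ w ⟫ lies in the Bose–Mesner algebra. Perfect state transfer u → v at τ
-- makes column u of M equal to c k e_v, so the class of (v , u) has valency one: it is the graph
-- of an involution σ, and M (σ w) w = c k for every w. As c² = 1 this is the equality case of
-- Cauchy–Schwarz, U^τ χ w = c χ (σ w); hence U^2τ fixes every χ w and every ψ w = U χ w. For any
-- x, U^2τ x − x lies in the span of these vectors and is orthogonal to it, so it vanishes. A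
-- period t < 2τ would give perfect state transfer u → v at τ − t, v → u at t − τ, or χ u = c χ v.

module Submission where

open import Defs

open import Data.Bool using (Bool; true; false; T; _∧_)
open import Data.Empty using (⊥; ⊥-elim)
open import Data.Fin using (Fin; zero; suc)
open import Data.Nat as ℕ using (ℕ; zero; suc)
open import Data.Product using (_×_; _,_; proj₁; proj₂; Σ-syntax)
open import Function using (_∘_)
open import Relation.Binary.PropositionalEquality
open import Relation.Nullary using (yes; no)

module Indicators where

  open import Data.Fin using (_≟_)

  ==-true : ∀ {n} {i j : Fin n} → i ≡ j → (i == j) ≡ true
  ==-true {i = i} {j} i≡j with i ≟ j
  ... | yes _   = refl
  ... | no i≢j = ⊥-elim (i≢j i≡j)

  ==-false : ∀ {n} {i j : Fin n} → i ≢ j → (i == j) ≡ false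
  ==-false {i = i} {j} i≢j with i ≟ j
  ... | yes i≡j = ⊥-elim (i≢j i≡j)
  ... | no _    = refl

  ==-refl : ∀ {n} (i : Fin n) → (i == i) ≡ true
  ==-refl i = ==-true refl

  ==-sym : ∀ {n} (i j : Fin n) → (i == j) ≡ (j == i)
  ==-sym i j with i ≟ j
  ... | yes i≡j = sym (==-true (sym i≡j))
  ... | no i≢j  = sym (==-false (i≢j ∘ sym))

  ==-suc : ∀ {n} (i j : Fin n) → (suc i == suc j) ≡ (i == j)
  ==-suc i j with i ≟ j
  ... | yes _ = refl
  ... | no _  = refl

module FiniteSums where

  open import Data.Rational using (ℚ; 0ℚ; 1ℚ; _+_; _*_; _-_; 1/_; _≤_; nonNegative; nonPositive; ≢-nonZero)
  open import Data.Rational.Properties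
  open import Data.Rational.Solver using (module +-*-Solver)
  open import Data.Sum using (inj₁; inj₂)
  open import Algebra.Bundles using (Ring)
  open import Algebra.Properties.Semiring.Sum (Ring.semiring +-*-ring)
    using (sum; ∑-distrib-+; ∑-comm; *-distribˡ-sum)
  open +-*-Solver
  open Indicators
  open ≡-Reasoning

  ΣF≡sum : ∀ n (f : Fin n → ℚ) → ΣF n f ≡ sum f
  ΣF≡sum zero    f = refl
  ΣF≡sum (suc n) f = cong (f zero +_) (ΣF≡sum n (f ∘ suc))

  ΣF-cong : ∀ n {f g : Fin n → ℚ} → (∀ i → f i ≡ g i) → ΣF n f ≡ ΣF n g
  ΣF-cong zero    f≗g = refl
  ΣF-cong (suc n) f≗g = cong₂ _+_ (f≗g zero) (ΣF-cong n (f≗g ∘ suc))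

  ΣF-+ : ∀ n (f g : Fin n → ℚ) → ΣF n (λ i → f i + g i) ≡ ΣF n f + ΣF n g
  ΣF-+ n f g = begin
    ΣF n (λ i → f i + g i)  ≡⟨ ΣF≡sum n _ ⟩
    sum (λ i → f i + g i)   ≡⟨ ∑-distrib-+ f g ⟩
    sum f + sum g           ≡⟨ cong₂ _+_ (ΣF≡sum n f) (ΣF≡sum n g) ⟨
    ΣF n f + ΣF n g         ∎

  ΣF-*ˡ : ∀ n c (f : Fin n → ℚ) → ΣF n (λ i → c * f i) ≡ c * ΣF n f
  ΣF-*ˡ n c f = begin
    ΣF n (λ i → c * f i)  ≡⟨ ΣF≡sum n _ ⟩
    sum (λ i → c * f i)   ≡⟨ *-distribˡ-sum c f ⟨
    c * sum f             ≡⟨ cong (c *_) (ΣF≡sum n f) ⟨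
    c * ΣF n f            ∎

  ΣF-zero : ∀ n → ΣF n (λ _ → 0ℚ) ≡ 0ℚ
  ΣF-zero zero    = refl
  ΣF-zero (suc n) = trans (+-identityˡ (ΣF n (λ _ → 0ℚ))) (ΣF-zero n)

  ΣF-*ʳ : ∀ n c (f : Fin n → ℚ) → ΣF n (λ i → f i * c) ≡ ΣF n f * c
  ΣF-*ʳ n c f = begin
    ΣF n (λ i → f i * c)  ≡⟨ ΣF-cong n (λ i → *-comm (f i) c) ⟩
    ΣF n (λ i → c * f i)  ≡⟨ ΣF-*ˡ n c f ⟩
    c * ΣF n f            ≡⟨ *-comm c _ ⟩
    ΣF n f * c            ∎

  ΣF-comm : ∀ m n (f : Fin m → Fin n → ℚ) →
            ΣF m (λ i → ΣF n (f i)) ≡ ΣF n (λ j → ΣF m (λ i → f i j))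
  ΣF-comm m n f = begin
    ΣF m (λ i → ΣF n (f i))            ≡⟨ ΣF-cong m (λ i → ΣF≡sum n (f i)) ⟩
    ΣF m (λ i → sum (f i))             ≡⟨ ΣF≡sum m _ ⟩
    sum (λ i → sum (f i))              ≡⟨ ∑-comm f ⟩
    sum (λ j → sum (λ i → f i j))      ≡⟨ ΣF≡sum n _ ⟨
    ΣF n (λ j → sum (λ i → f i j))     ≡⟨ ΣF-cong n (λ j → ΣF≡sum m _) ⟨
    ΣF n (λ j → ΣF m (λ i → f i j))    ∎

  ΣF-*-ΣF : ∀ m n (f : Fin m → ℚ) (g : Fin n → ℚ) →
            ΣF m f * ΣF n g ≡ ΣF m (λ i → ΣF n (λ j → f i * g j))
  ΣF-*-ΣF m n f g = begin
    ΣF m f * ΣF n g                        ≡⟨ ΣF-*ʳ m (ΣF n g) f ⟨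
    ΣF m (λ i → f i * ΣF n g)              ≡⟨ ΣF-cong m (λ i → ΣF-*ˡ n (f i) g) ⟨
    ΣF m (λ i → ΣF n (λ j → f i * g j))    ∎

  ΣF-- : ∀ n (f g : Fin n → ℚ) → ΣF n (λ i → f i - g i) ≡ ΣF n f - ΣF n g
  ΣF-- zero    f g = refl
  ΣF-- (suc n) f g = begin
    (f₀ - g₀) + ΣF n (λ i → f (suc i) - g (suc i))  ≡⟨ cong ((f₀ - g₀) +_) (ΣF-- n (f ∘ suc) (g ∘ suc)) ⟩
    (f₀ - g₀) + (ΣF n (f ∘ suc) - ΣF n (g ∘ suc))   ≡⟨ interchange f₀ g₀ _ _ ⟩
    (f₀ + ΣF n (f ∘ suc)) - (g₀ + ΣF n (g ∘ suc))   ∎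
    where
    f₀ = f zero
    g₀ = g zero
    interchange : ∀ a b c d → (a - b) + (c - d) ≡ (a + c) - (b + d)
    interchange = solve 4 (λ a b c d → (a :- b) :+ (c :- d) := (a :+ c) :- (b :+ d)) refl

  b2ℚ-∧ : ∀ p q → b2ℚ (p ∧ q) ≡ b2ℚ p * b2ℚ q
  b2ℚ-∧ true  q = sym (*-identityˡ (b2ℚ q))
  b2ℚ-∧ false q = sym (*-zeroˡ (b2ℚ q))

  b2ℚ-*-cong : ∀ b {p q} → (T b → p ≡ q) → b2ℚ b * p ≡ b2ℚ b * q
  b2ℚ-*-cong true  p≡q = cong (1ℚ *_) (p≡q _)
  b2ℚ-*-cong false {p} {q} _ = trans (*-zeroˡ p) (sym (*-zeroˡ q))

  ΣF-pick : ∀ n (j : Fin n) (f : Fin n → ℚ) → ΣF n (λ i → b2ℚ (i == j) * f i) ≡ f j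
  ΣF-pick (suc n) zero f = begin
    1ℚ * f zero + ΣF n (λ i → 0ℚ * f (suc i))  ≡⟨ cong₂ _+_ (*-identityˡ (f zero)) (ΣF-*ˡ n 0ℚ (f ∘ suc)) ⟩
    f zero + 0ℚ * ΣF n (f ∘ suc)               ≡⟨ cong (f zero +_) (*-zeroˡ (ΣF n (f ∘ suc))) ⟩
    f zero + 0ℚ                                ≡⟨ +-identityʳ (f zero) ⟩
    f zero                                     ∎
  ΣF-pick (suc n) (suc j) f = begin
    0ℚ * f zero + ΣF n (λ i → b2ℚ (suc i == suc j) * f (suc i))
      ≡⟨ cong₂ _+_ (*-zeroˡ (f zero)) (ΣF-cong n (λ i → cong (λ b → b2ℚ b * f (suc i)) (==-suc i j))) ⟩
    0ℚ + ΣF n (λ i → b2ℚ (i == j) * f (suc i))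
      ≡⟨ +-identityˡ _ ⟩
    ΣF n (λ i → b2ℚ (i == j) * f (suc i))
      ≡⟨ ΣF-pick n j (f ∘ suc) ⟩
    f (suc j)
      ∎

  square-nonneg : ∀ x → 0ℚ ≤ x * x
  square-nonneg x with ≤-total 0ℚ x
  ... | inj₁ 0≤x = nonNegative⁻¹ _ {{nonNeg*nonNeg⇒nonNeg x {{nonNegative 0≤x}} x {{nonNegative 0≤x}}}}
  ... | inj₂ x≤0 = nonNegative⁻¹ _ {{nonPos*nonPos⇒nonPos x {{nonPositive x≤0}} x {{nonPositive x≤0}}}}

  square-zero : ∀ x → x * x ≡ 0ℚ → x ≡ 0ℚ
  square-zero x x²≡0 with x ≟ 0ℚ
  ... | yes x≡0 = x≡0
  ... | no x≢0 = begin
    x                 ≡⟨ *-identityˡ x ⟨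
    1ℚ * x            ≡⟨ cong (_* x) (*-inverseˡ x) ⟨
    (1/ x) * x * x    ≡⟨ *-assoc (1/ x) x x ⟩
    (1/ x) * (x * x)  ≡⟨ cong ((1/ x) *_) x²≡0 ⟩
    (1/ x) * 0ℚ       ≡⟨ *-zeroʳ (1/ x) ⟩
    0ℚ                ∎
    where instance _ = ≢-nonZero x≢0

  ΣF-nonneg : ∀ n (f : Fin n → ℚ) → (∀ i → 0ℚ ≤ f i) → 0ℚ ≤ ΣF n f
  ΣF-nonneg zero    f 0≤f = ≤-refl
  ΣF-nonneg (suc n) f 0≤f = +-mono-≤ (0≤f zero) (ΣF-nonneg n (f ∘ suc) (0≤f ∘ suc))

  nonneg-+-zero : ∀ {p q} → 0ℚ ≤ p → 0ℚ ≤ q → p + q ≡ 0ℚ → p ≡ 0ℚ × q ≡ 0ℚ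
  nonneg-+-zero {p} {q} 0≤p 0≤q p+q≡0 =
      ≤-antisym (subst₂ _≤_ (+-identityʳ p) p+q≡0 (+-monoʳ-≤ p 0≤q)) 0≤p
    , ≤-antisym (subst₂ _≤_ (+-identityˡ q) p+q≡0 (+-monoˡ-≤ q 0≤p)) 0≤q

  ΣF-nonneg-zero : ∀ n (f : Fin n → ℚ) → (∀ i → 0ℚ ≤ f i) → ΣF n f ≡ 0ℚ → ∀ i → f i ≡ 0ℚ
  ΣF-nonneg-zero (suc n) f 0≤f Σf≡0 = at
    where
    split : f zero ≡ 0ℚ × ΣF n (f ∘ suc) ≡ 0ℚ
    split = nonneg-+-zero (0≤f zero) (ΣF-nonneg n (f ∘ suc) (0≤f ∘ suc)) Σf≡0
    at : ∀ i → f i ≡ 0ℚ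
    at zero    = proj₁ split
    at (suc i) = ΣF-nonneg-zero n (f ∘ suc) (0≤f ∘ suc) (proj₂ split) i

module Counting where

  import Data.Integer as ℤ
  import Data.Integer.Properties as ℤ
  import Data.Nat.Coprimality as Coprimality
  open import Data.Rational using (ℚ; 1ℚ; _+_; _*_; _/_; mkℚ; ↥_)
  open import Data.Rational.Properties using (normalize-coprime; *-inverseˡ; +-identityˡ; *-identityʳ)
  open Indicators
  open FiniteSums
  open ≡-Reasoning

  fromℕ : ℕ → ℚ
  fromℕ m = ℤ.+ m / 1

  fromℕ≡mkℚ : ∀ m → fromℕ m ≡ mkℚ (ℤ.+ m) 0 (Coprimality.sym (Coprimality.1-coprimeTo m))
  fromℕ≡mkℚ m = normalize-coprime (Coprimality.sym (Coprimality.1-coprimeTo m))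

  fromℕ-injective : ∀ {a b} → fromℕ a ≡ fromℕ b → a ≡ b
  fromℕ-injective {a} {b} eq = cong (ℤ.∣_∣ ∘ ↥_) (trans (sym (fromℕ≡mkℚ a)) (trans eq (fromℕ≡mkℚ b)))

  fromℕ-suc : ∀ m → fromℕ (suc m) ≡ 1ℚ + fromℕ m
  fromℕ-suc m = begin
    (ℤ.+ 1 ℤ.+ ℤ.+ m) / 1                                        ≡⟨ cong (λ z → (ℤ.+ 1 ℤ.+ z) / 1) (ℤ.*-identityʳ (ℤ.+ m)) ⟨
    (ℤ.+ 1 ℤ.+ ℤ.+ m ℤ.* ℤ.+ 1) / 1                              ≡⟨⟩
    1ℚ + mkℚ (ℤ.+ m) 0 (Coprimality.sym (Coprimality.1-coprimeTo m))  ≡⟨ cong (1ℚ +_) (fromℕ≡mkℚ m) ⟨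
    1ℚ + fromℕ m                                                 ∎

  1/suc-inverse : ∀ k → (ℤ.+ 1 / suc k) * fromℕ (suc k) ≡ 1ℚ
  1/suc-inverse k = trans (cong₂ _*_ (normalize-coprime (Coprimality.1-coprimeTo (suc k))) (fromℕ≡mkℚ (suc k)))
                          (*-inverseˡ (mkℚ (ℤ.+ suc k) 0 (Coprimality.sym (Coprimality.1-coprimeTo (suc k)))))

  ΣF-count : ∀ n (f : Fin n → Bool) → ΣF n (b2ℚ ∘ f) ≡ fromℕ (ΣFℕ n (b2ℕ ∘ f))
  ΣF-count zero    f = refl
  ΣF-count (suc n) f with f zero
  ... | true  = trans (cong (1ℚ +_) (ΣF-count n (f ∘ suc))) (sym (fromℕ-suc (ΣFℕ n (b2ℕ ∘ f ∘ suc))))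
  ... | false = trans (+-identityˡ _) (ΣF-count n (f ∘ suc))

  count-singleton : ∀ n (f : Fin n → Bool) v → (∀ y → f y ≡ (y == v)) → ΣFℕ n (b2ℕ ∘ f) ≡ 1
  count-singleton n f v f≡[=v] = fromℕ-injective (begin
    fromℕ (ΣFℕ n (b2ℕ ∘ f))          ≡⟨ ΣF-count n f ⟨
    ΣF n (b2ℚ ∘ f)                   ≡⟨ ΣF-cong n (λ y → trans (cong b2ℚ (f≡[=v] y)) (sym (*-identityʳ (b2ℚ (y == v))))) ⟩
    ΣF n (λ y → b2ℚ (y == v) * 1ℚ)   ≡⟨ ΣF-pick n v (λ _ → 1ℚ) ⟩
    1ℚ                               ∎)

  count-zero : ∀ m (f : Fin m → Bool) → ΣFℕ m (b2ℕ ∘ f) ≡ 0 → ∀ j → f j ≡ false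
  count-zero (suc m) f count≡0 j with f zero in f₀
  count-zero (suc m) f ()      j       | true
  count-zero (suc m) f count≡0 zero    | false = f₀
  count-zero (suc m) f count≡0 (suc j) | false = count-zero m (f ∘ suc) count≡0 j

  count-one : ∀ m (f : Fin m → Bool) → ΣFℕ m (b2ℕ ∘ f) ≡ 1 →
              Σ[ i ∈ Fin m ] f i ≡ true × (∀ j → f j ≡ true → j ≡ i)
  count-one (suc m) f count≡1 with f zero in f₀
  ... | true = zero , f₀ , only-zero
    where
    only-zero : ∀ j → f j ≡ true → j ≡ zero
    only-zero zero    _   = refl
    only-zero (suc j) fj with trans (sym fj) (count-zero m (f ∘ suc) (cong ℕ.pred count≡1) j)
    ... | ()
  ... | false with count-one m (f ∘ suc) count≡1
  ...   | i , fi , only-i = suc i , fi , only-suc-i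
    where
    only-suc-i : ∀ j → f j ≡ true → j ≡ suc i
    only-suc-i zero    f₀≡true with trans (sym f₀≡true) f₀
    ... | ()
    only-suc-i (suc j) fj = cong suc (only-i j fj)

  count-nonzero : ∀ m (f : Fin m → Bool) → ΣFℕ m (b2ℕ ∘ f) ≢ 0 → Σ[ i ∈ Fin m ] f i ≡ true
  count-nonzero zero    f count≢0 = ⊥-elim (count≢0 refl)
  count-nonzero (suc m) f count≢0 with f zero in f₀
  ... | true  = zero , f₀
  ... | false with count-nonzero m (f ∘ suc) count≢0
  ...   | i , fi = suc i , fi

module BoseMesner {n d : ℕ} (𝒜 : AssocScheme n d) where

  open import Data.Rational using (ℚ; 0ℚ; 1ℚ; _+_; _*_; -_)
  open import Data.Rational.Properties using (*-comm; *-identityʳ; *-1-commutativeMonoid)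
  open import Algebra.Bundles using (CommutativeMonoid)
  open import Algebra.Properties.CommutativeSemigroup (CommutativeMonoid.commutativeSemigroup *-1-commutativeMonoid)
    using (interchange)
  open AssocScheme 𝒜
  open Indicators
  open FiniteSums
  open Counting
  open ≡-Reasoning

  private
    class : ∀ x y → Σ[ i ∈ Fin (suc d) ] A i x y ≡ true × (∀ j → A j x y ≡ true → j ≡ i)
    class x y = count-one (suc d) (λ i → A i x y) (sum-J x y)

  cls : Fin n → Fin n → Fin (suc d)
  cls x y = proj₁ (class x y)

  A-cls : ∀ x y → A (cls x y) x y ≡ true
  A-cls x y = proj₁ (proj₂ (class x y))

  cls-unique : ∀ j x y → A j x y ≡ true → j ≡ cls x y
  cls-unique j x y = proj₂ (proj₂ (class x y)) j

  A≡cls : ∀ j x y → A j x y ≡ (j == cls x y)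
  A≡cls j x y with A j x y in Ajxy
  ... | true  = sym (==-true (cls-unique j x y Ajxy))
  ... | false = sym (==-false j≢cls)
    where
    j≢cls : j ≢ cls x y
    j≢cls refl with trans (sym Ajxy) (A-cls x y)
    ... | ()

  cls-diag : ∀ x → cls x x ≡ zero
  cls-diag x = sym (cls-unique zero x x (trans (A₀-id x x) (==-refl x)))

  Σ-classes : ∀ (m : Fin (suc d) → ℚ) x y → ΣF (suc d) (λ k → m k * b2ℚ (A k x y)) ≡ m (cls x y)
  Σ-classes m x y = begin
    ΣF (suc d) (λ k → m k * b2ℚ (A k x y))          ≡⟨ ΣF-cong (suc d) (λ k → cong (λ b → m k * b2ℚ b) (A≡cls k x y)) ⟩
    ΣF (suc d) (λ k → m k * b2ℚ (k == cls x y))     ≡⟨ ΣF-cong (suc d) (λ k → *-comm (m k) (b2ℚ (k == cls x y))) ⟩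
    ΣF (suc d) (λ k → b2ℚ (k == cls x y) * m k)     ≡⟨ ΣF-pick (suc d) (cls x y) m ⟩
    m (cls x y)                                     ∎

  -- Equivalent to lying in span {A₀, …, A_d}, as the classes partition Fin n × Fin n.
  InSpan : (Fin n → Fin n → ℚ) → Set
  InSpan M = Σ[ m ∈ (Fin (suc d) → ℚ) ] ∀ x y → M x y ≡ m (cls x y)

  InSpan-cong : ∀ {M N} → (∀ x y → M x y ≡ N x y) → InSpan N → InSpan M
  InSpan-cong M≡N (m , N≡m) = m , λ x y → trans (M≡N x y) (N≡m x y)

  InSpan-A : ∀ i → InSpan (λ x y → b2ℚ (A i x y))
  InSpan-A i = (λ j → b2ℚ (i == j)) , λ x y → cong b2ℚ (A≡cls i x y)

  InSpan-I : InSpan (λ x y → b2ℚ (x == y))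
  InSpan-I = (λ j → b2ℚ (zero == j)) , λ x y → cong b2ℚ (trans (sym (A₀-id x y)) (A≡cls zero x y))

  InSpan-J : InSpan (λ _ _ → 1ℚ)
  InSpan-J = (λ _ → 1ℚ) , λ _ _ → refl

  InSpan-0 : InSpan (λ _ _ → 0ℚ)
  InSpan-0 = (λ _ → 0ℚ) , λ _ _ → refl

  InSpan-+ : ∀ {M N} → InSpan M → InSpan N → InSpan (λ x y → M x y + N x y)
  InSpan-+ (m , M≡m) (m' , N≡m') = (λ j → m j + m' j) , λ x y → cong₂ _+_ (M≡m x y) (N≡m' x y)

  InSpan-*ˡ : ∀ c {M} → InSpan M → InSpan (λ x y → c * M x y)
  InSpan-*ˡ c (m , M≡m) = (λ j → c * m j) , λ x y → cong (c *_) (M≡m x y)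

  InSpan-neg : ∀ {M} → InSpan M → InSpan (λ x y → - M x y)
  InSpan-neg (m , M≡m) = (λ j → - m j) , λ x y → cong -_ (M≡m x y)

  InSpan-product : ∀ {M N} → InSpan M → InSpan N → InSpan (λ x y → ΣF n (λ z → M x z * N z y))
  InSpan-product {M} {N} (m , M≡m) (m' , N≡m') = coefficient , MN≡coefficient
    where
    𝟙 : Fin (suc d) → Fin n → Fin n → ℚ
    𝟙 i x y = b2ℚ (A i x y)
    p : Fin (suc d) → Fin (suc d) → Fin (suc d) → ℚ
    p i j = proj₁ (closed i j)
    coefficient : Fin (suc d) → ℚ
    coefficient l = ΣF (suc d) (λ i → ΣF (suc d) (λ j → (m i * m' j) * p i j l))
    expand : ∀ K (k : Fin (suc d) → ℚ) → (∀ x y → K x y ≡ k (cls x y)) →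
             ∀ x y → K x y ≡ ΣF (suc d) (λ i → k i * 𝟙 i x y)
    expand K k K≡k x y = trans (K≡k x y) (sym (Σ-classes k x y))
    MN≡coefficient : ∀ x y → ΣF n (λ z → M x z * N z y) ≡ coefficient (cls x y)
    MN≡coefficient x y = begin
      ΣF n (λ z → M x z * N z y)
        ≡⟨ ΣF-cong n (λ z → cong₂ _*_ (expand M m M≡m x z) (expand N m' N≡m' z y)) ⟩
      ΣF n (λ z → ΣF (suc d) (λ i → m i * 𝟙 i x z) * ΣF (suc d) (λ j → m' j * 𝟙 j z y))
        ≡⟨ ΣF-cong n (λ z → ΣF-*-ΣF (suc d) (suc d) (λ i → m i * 𝟙 i x z) (λ j → m' j * 𝟙 j z y)) ⟩
      ΣF n (λ z → ΣF (suc d) (λ i → ΣF (suc d) (λ j → term i j z)))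
        ≡⟨ ΣF-comm n (suc d) (λ z i → ΣF (suc d) (λ j → term i j z)) ⟩
      ΣF (suc d) (λ i → ΣF n (λ z → ΣF (suc d) (λ j → term i j z)))
        ≡⟨ ΣF-cong (suc d) (λ i → ΣF-comm n (suc d) (λ z j → term i j z)) ⟩
      ΣF (suc d) (λ i → ΣF (suc d) (λ j → ΣF n (λ z → term i j z)))
        ≡⟨ ΣF-cong (suc d) (λ i → ΣF-cong (suc d) (λ j → trans
             (ΣF-cong n (λ z → interchange (m i) (𝟙 i x z) (m' j) (𝟙 j z y)))
             (ΣF-*ˡ n (m i * m' j) (λ z → 𝟙 i x z * 𝟙 j z y)))) ⟩
      ΣF (suc d) (λ i → ΣF (suc d) (λ j → (m i * m' j) * ΣF n (λ z → 𝟙 i x z * 𝟙 j z y)))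
        ≡⟨ ΣF-cong (suc d) (λ i → ΣF-cong (suc d) (λ j →
             cong ((m i * m' j) *_) (trans (proj₂ (closed i j) x y) (Σ-classes (p i j) x y)))) ⟩
      coefficient (cls x y)
        ∎
      where
      term : Fin (suc d) → Fin (suc d) → Fin n → ℚ
      term i j z = (m i * 𝟙 i x z) * (m' j * 𝟙 j z y)

  InSpan-diagonal : ∀ {M} → InSpan M → ∀ w w' → M w w ≡ M w' w'
  InSpan-diagonal {M} (m , M≡m) w w' = begin
    M w w             ≡⟨ M≡m w w ⟩
    m (cls w w)       ≡⟨ cong m (trans (cls-diag w) (sym (cls-diag w'))) ⟩
    m (cls w' w')     ≡⟨ M≡m w' w' ⟨
    M w' w'           ∎

  -- Row sums of M are the diagonal of M J, and diagonals are constant since cls w w ≡ zero.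
  InSpan-rowSum : ∀ {M} → InSpan M → ∀ w w' → ΣF n (M w) ≡ ΣF n (M w')
  InSpan-rowSum {M} M∈ w w' = begin
    ΣF n (M w)                  ≡⟨ ΣF-cong n (λ z → *-identityʳ (M w z)) ⟨
    ΣF n (λ z → M w z * 1ℚ)     ≡⟨ InSpan-diagonal (InSpan-product M∈ InSpan-J) w w' ⟩
    ΣF n (λ z → M w' z * 1ℚ)    ≡⟨ ΣF-cong n (λ z → *-identityʳ (M w' z)) ⟩
    ΣF n (M w')                 ∎

  rowCount-const : ∀ (f : Fin n → Fin n → Bool) → InSpan (λ x y → b2ℚ (f x y)) →
                   ∀ w w' → ΣFℕ n (b2ℕ ∘ f w) ≡ ΣFℕ n (b2ℕ ∘ f w')
  rowCount-const f f∈ w w' = fromℕ-injective (begin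
    fromℕ (ΣFℕ n (b2ℕ ∘ f w))   ≡⟨ ΣF-count n (f w) ⟨
    ΣF n (b2ℚ ∘ f w)            ≡⟨ InSpan-rowSum f∈ w w' ⟩
    ΣF n (b2ℚ ∘ f w')           ≡⟨ ΣF-count n (f w') ⟩
    fromℕ (ΣFℕ n (b2ℕ ∘ f w'))  ∎)

  InSpan-adj : ∀ (G : Graph n) → BelongsTo G 𝒜 → InSpan (λ x y → b2ℚ (Graph.adj G x y))
  InSpan-adj G (c , adj≡Σc) = c , λ x y → trans (adj≡Σc x y) (Σ-classes c x y)

  belongsTo⇒regular : ∀ (G : Graph n) → BelongsTo G 𝒜 → ∀ w w' → deg G w ≡ deg G w'
  belongsTo⇒regular G G∈𝒜 = rowCount-const (Graph.adj G) (InSpan-adj G G∈𝒜)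

  module ValencyOne (i : Fin (suc d)) (u : Fin n) (valency≡1 : ΣFℕ n (b2ℕ ∘ A i u) ≡ 1) where

    private
      unique-partner : ∀ w → Σ[ y ∈ Fin n ] A i w y ≡ true × (∀ z → A i w z ≡ true → z ≡ y)
      unique-partner w = count-one n (A i w) (trans (rowCount-const (A i) (InSpan-A i) w u) valency≡1)

    partner : Fin n → Fin n
    partner w = proj₁ (unique-partner w)

    A-partner : ∀ w → A i w (partner w) ≡ true
    A-partner w = proj₁ (proj₂ (unique-partner w))

    partner-unique : ∀ w z → A i w z ≡ true → z ≡ partner w
    partner-unique w = proj₂ (proj₂ (unique-partner w))

    partner-involutive : ∀ w → partner (partner w) ≡ w
    partner-involutive w =
      sym (partner-unique (partner w) w (trans (A-sym i (partner w) w) (A-partner w)))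

module ArcSpace {n : ℕ} (G : Graph n) where

  open import Data.Bool.Properties using (T-≡; ∧-comm)
  open import Function.Bundles using (Equivalence)
  open import Data.Rational using (ℚ; 0ℚ; 1ℚ; _+_; _*_; _-_; _≤_)
  open import Data.Rational.Properties
  open import Data.Rational.Solver using (module +-*-Solver)
  open +-*-Solver
  open import Algebra.Bundles using (CommutativeMonoid)
  open import Algebra.Properties.CommutativeSemigroup (CommutativeMonoid.commutativeSemigroup *-1-commutativeMonoid)
    using (x∙yz≈y∙xz)
  open import Algebra.Properties.Group +-0-group using (x∙y⁻¹≈ε⇒x≈y)
  open Graph G
  open Indicators
  open FiniteSums
  open ≡-Reasoning

  Arc : Set
  Arc = Pair G

  Vec : Set
  Vec = VecA G

  -- Arc vectors are functions on all pairs of vertices; only their values on arcs matter.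
  infix 4 _≈_
  _≈_ : Vec → Vec → Set
  x ≈ y = ∀ a → IsArc G a → x a ≡ y a

  𝟙ₐ : Arc → ℚ
  𝟙ₐ a = b2ℚ (isArc G a)

  arc⇒true : ∀ {a} → IsArc G a → isArc G a ≡ true
  arc⇒true = Equivalence.to T-≡

  inv-arc : ∀ a → IsArc G a → IsArc G (inv G a)
  inv-arc (u , v) = subst T (symmetric u v)

  ΣA-cong : ∀ {f g : Arc → ℚ} → f ≈ g → ΣA G f ≡ ΣA G g
  ΣA-cong f≈g = ΣF-cong n (λ u → ΣF-cong n (λ v → b2ℚ-*-cong (adj u v) (f≈g (u , v))))

  ΣA-+ : ∀ (f g : Arc → ℚ) → ΣA G (λ a → f a + g a) ≡ ΣA G f + ΣA G g
  ΣA-+ f g = begin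
    ΣF n (λ u → ΣF n (λ v → 𝟙ₐ (u , v) * (f (u , v) + g (u , v))))
      ≡⟨ ΣF-cong n (λ u → ΣF-cong n (λ v → *-distribˡ-+ (𝟙ₐ (u , v)) (f (u , v)) (g (u , v)))) ⟩
    ΣF n (λ u → ΣF n (λ v → 𝟙ₐ (u , v) * f (u , v) + 𝟙ₐ (u , v) * g (u , v)))
      ≡⟨ ΣF-cong n (λ u → ΣF-+ n (λ v → 𝟙ₐ (u , v) * f (u , v)) (λ v → 𝟙ₐ (u , v) * g (u , v))) ⟩
    ΣF n (λ u → ΣF n (λ v → 𝟙ₐ (u , v) * f (u , v)) + ΣF n (λ v → 𝟙ₐ (u , v) * g (u , v)))
      ≡⟨ ΣF-+ n (λ u → ΣF n (λ v → 𝟙ₐ (u , v) * f (u , v))) (λ u → ΣF n (λ v → 𝟙ₐ (u , v) * g (u , v))) ⟩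
    ΣA G f + ΣA G g
      ∎

  ΣA-- : ∀ (f g : Arc → ℚ) → ΣA G (λ a → f a - g a) ≡ ΣA G f - ΣA G g
  ΣA-- f g = begin
    ΣF n (λ u → ΣF n (λ v → 𝟙ₐ (u , v) * (f (u , v) - g (u , v))))
      ≡⟨ ΣF-cong n (λ u → ΣF-cong n (λ v → distrib (𝟙ₐ (u , v)) (f (u , v)) (g (u , v)))) ⟩
    ΣF n (λ u → ΣF n (λ v → 𝟙ₐ (u , v) * f (u , v) - 𝟙ₐ (u , v) * g (u , v)))
      ≡⟨ ΣF-cong n (λ u → ΣF-- n (λ v → 𝟙ₐ (u , v) * f (u , v)) (λ v → 𝟙ₐ (u , v) * g (u , v))) ⟩
    ΣF n (λ u → ΣF n (λ v → 𝟙ₐ (u , v) * f (u , v)) - ΣF n (λ v → 𝟙ₐ (u , v) * g (u , v)))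
      ≡⟨ ΣF-- n (λ u → ΣF n (λ v → 𝟙ₐ (u , v) * f (u , v))) (λ u → ΣF n (λ v → 𝟙ₐ (u , v) * g (u , v))) ⟩
    ΣA G f - ΣA G g
      ∎
    where
    distrib : ∀ b x y → b * (x - y) ≡ b * x - b * y
    distrib = solve 3 (λ b x y → b :* (x :- y) := b :* x :- b :* y) refl

  ΣA-*ˡ : ∀ c (f : Arc → ℚ) → ΣA G (λ a → c * f a) ≡ c * ΣA G f
  ΣA-*ˡ c f = begin
    ΣF n (λ u → ΣF n (λ v → 𝟙ₐ (u , v) * (c * f (u , v))))
      ≡⟨ ΣF-cong n (λ u → ΣF-cong n (λ v → x∙yz≈y∙xz (𝟙ₐ (u , v)) c (f (u , v)))) ⟩
    ΣF n (λ u → ΣF n (λ v → c * (𝟙ₐ (u , v) * f (u , v))))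
      ≡⟨ ΣF-cong n (λ u → ΣF-*ˡ n c (λ v → 𝟙ₐ (u , v) * f (u , v))) ⟩
    ΣF n (λ u → c * ΣF n (λ v → 𝟙ₐ (u , v) * f (u , v)))
      ≡⟨ ΣF-*ˡ n c (λ u → ΣF n (λ v → 𝟙ₐ (u , v) * f (u , v))) ⟩
    c * ΣA G f
      ∎

  ΣA-*ʳ : ∀ c (f : Arc → ℚ) → ΣA G (λ a → f a * c) ≡ ΣA G f * c
  ΣA-*ʳ c f = begin
    ΣA G (λ a → f a * c)  ≡⟨ ΣA-cong (λ a _ → *-comm (f a) c) ⟩
    ΣA G (λ a → c * f a)  ≡⟨ ΣA-*ˡ c f ⟩
    c * ΣA G f            ≡⟨ *-comm c (ΣA G f) ⟩
    ΣA G f * c            ∎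

  private
    Σ² : (Arc → ℚ) → ℚ
    Σ² f = ΣF n (λ u → ΣF n (λ v → f (u , v)))

    Σ²-cong : ∀ {f g : Arc → ℚ} → (∀ a → f a ≡ g a) → Σ² f ≡ Σ² g
    Σ²-cong f≗g = ΣF-cong n (λ u → ΣF-cong n (λ v → f≗g (u , v)))

    Σ²-comm : ∀ (h : Arc → Arc → ℚ) → Σ² (λ a → Σ² (h a)) ≡ Σ² (λ b → Σ² (λ a → h a b))
    Σ²-comm h = begin
      ΣF n (λ u → ΣF n (λ v → ΣF n (λ u' → ΣF n (λ v' → h (u , v) (u' , v')))))
        ≡⟨ ΣF-cong n (λ u → ΣF-comm n n (λ v u' → ΣF n (λ v' → h (u , v) (u' , v')))) ⟩
      ΣF n (λ u → ΣF n (λ u' → ΣF n (λ v → ΣF n (λ v' → h (u , v) (u' , v')))))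
        ≡⟨ ΣF-cong n (λ u → ΣF-cong n (λ u' → ΣF-comm n n (λ v v' → h (u , v) (u' , v')))) ⟩
      ΣF n (λ u → ΣF n (λ u' → ΣF n (λ v' → ΣF n (λ v → h (u , v) (u' , v')))))
        ≡⟨ ΣF-comm n n (λ u u' → ΣF n (λ v' → ΣF n (λ v → h (u , v) (u' , v')))) ⟩
      ΣF n (λ u' → ΣF n (λ u → ΣF n (λ v' → ΣF n (λ v → h (u , v) (u' , v')))))
        ≡⟨ ΣF-cong n (λ u' → ΣF-comm n n (λ u v' → ΣF n (λ v → h (u , v) (u' , v')))) ⟩
      ΣF n (λ u' → ΣF n (λ v' → ΣF n (λ u → ΣF n (λ v → h (u , v) (u' , v')))))
        ∎

  ΣA-comm : ∀ (h : Arc → Arc → ℚ) → ΣA G (λ a → ΣA G (h a)) ≡ ΣA G (λ b → ΣA G (λ a → h a b))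
  ΣA-comm h = begin
    Σ² (λ a → 𝟙ₐ a * ΣA G (h a))                      ≡⟨ Σ²-cong (λ a → ΣA-*ˡ (𝟙ₐ a) (h a)) ⟨
    Σ² (λ a → Σ² (λ b → 𝟙ₐ b * (𝟙ₐ a * h a b)))       ≡⟨ Σ²-comm (λ a b → 𝟙ₐ b * (𝟙ₐ a * h a b)) ⟩
    Σ² (λ b → Σ² (λ a → 𝟙ₐ b * (𝟙ₐ a * h a b)))       ≡⟨ Σ²-cong (λ b → Σ²-cong (λ a → x∙yz≈y∙xz (𝟙ₐ b) (𝟙ₐ a) (h a b))) ⟩
    Σ² (λ b → Σ² (λ a → 𝟙ₐ a * (𝟙ₐ b * h a b)))       ≡⟨ Σ²-cong (λ b → ΣA-*ˡ (𝟙ₐ b) (λ a → h a b)) ⟩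
    Σ² (λ b → 𝟙ₐ b * ΣA G (λ a → h a b))              ∎

  ΣA-inv : ∀ (f : Arc → ℚ) → ΣA G (f ∘ inv G) ≡ ΣA G f
  ΣA-inv f = begin
    ΣF n (λ u → ΣF n (λ v → b2ℚ (adj u v) * f (v , u)))   ≡⟨ ΣF-comm n n (λ u v → b2ℚ (adj u v) * f (v , u)) ⟩
    ΣF n (λ v → ΣF n (λ u → b2ℚ (adj u v) * f (v , u)))   ≡⟨ ΣF-cong n (λ v → ΣF-cong n (λ u →
                                                               cong (λ b → b2ℚ b * f (v , u)) (symmetric u v))) ⟩
    ΣF n (λ v → ΣF n (λ u → b2ℚ (adj v u) * f (v , u)))   ∎

  inflow : Vec → Fin n → ℚ
  inflow x w = ΣF n (λ u → b2ℚ (adj u w) * x (u , w))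

  outflow : Vec → Fin n → ℚ
  outflow x w = ΣF n (λ v → b2ℚ (adj w v) * x (w , v))

  inflow-cong : ∀ {y z} → y ≈ z → ∀ w → inflow y w ≡ inflow z w
  inflow-cong y≈z w = ΣF-cong n (λ u → b2ℚ-*-cong (adj u w) (y≈z (u , w)))

  inflow-*ˡ : ∀ c x w → inflow (λ a → c * x a) w ≡ c * inflow x w
  inflow-*ˡ c x w = trans (ΣF-cong n (λ u → x∙yz≈y∙xz (b2ℚ (adj u w)) c (x (u , w))))
                          (ΣF-*ˡ n c (λ u → b2ℚ (adj u w) * x (u , w)))

  ΣA-byTarget : ∀ (F : Fin n → ℚ) (x : Vec) → ΣA G (λ a → F (tgt G a) * x a) ≡ ΣF n (λ w → F w * inflow x w)
  ΣA-byTarget F x = begin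
    ΣF n (λ u → ΣF n (λ w → b2ℚ (adj u w) * (F w * x (u , w))))
      ≡⟨ ΣF-comm n n (λ u w → b2ℚ (adj u w) * (F w * x (u , w))) ⟩
    ΣF n (λ w → ΣF n (λ u → b2ℚ (adj u w) * (F w * x (u , w))))
      ≡⟨ ΣF-cong n (λ w → ΣF-cong n (λ u → x∙yz≈y∙xz (b2ℚ (adj u w)) (F w) (x (u , w)))) ⟩
    ΣF n (λ w → ΣF n (λ u → F w * (b2ℚ (adj u w) * x (u , w))))
      ≡⟨ ΣF-cong n (λ w → ΣF-*ˡ n (F w) (λ u → b2ℚ (adj u w) * x (u , w))) ⟩
    ΣF n (λ w → F w * inflow x w)
      ∎

  ΣA-bySource : ∀ (F : Fin n → ℚ) (x : Vec) → ΣA G (λ a → F (proj₁ a) * x a) ≡ ΣF n (λ w → F w * outflow x w)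
  ΣA-bySource F x = ΣF-cong n (λ w → trans
    (ΣF-cong n (λ v → x∙yz≈y∙xz (b2ℚ (adj w v)) (F w) (x (w , v))))
    (ΣF-*ˡ n (F w) (λ v → b2ℚ (adj w v) * x (w , v))))

  ΣA-pick : ∀ b → IsArc G b → (g : Arc → ℚ) → ΣA G (λ c → b2ℚ (eqP G c b) * g c) ≡ g b
  ΣA-pick (b₁ , b₂) b-arc g = begin
    ΣF n (λ u → ΣF n (λ v → 𝟙ₐ (u , v) * (b2ℚ ((u == b₁) ∧ (v == b₂)) * g (u , v))))
      ≡⟨ ΣF-cong n (λ u → ΣF-cong n (λ v → factor (u == b₁) (v == b₂) (𝟙ₐ (u , v)) (g (u , v)))) ⟩
    ΣF n (λ u → ΣF n (λ v → b2ℚ (u == b₁) * (b2ℚ (v == b₂) * (𝟙ₐ (u , v) * g (u , v)))))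
      ≡⟨ ΣF-cong n (λ u → ΣF-*ˡ n (b2ℚ (u == b₁)) (λ v → b2ℚ (v == b₂) * (𝟙ₐ (u , v) * g (u , v)))) ⟩
    ΣF n (λ u → b2ℚ (u == b₁) * ΣF n (λ v → b2ℚ (v == b₂) * (𝟙ₐ (u , v) * g (u , v))))
      ≡⟨ ΣF-pick n b₁ (λ u → ΣF n (λ v → b2ℚ (v == b₂) * (𝟙ₐ (u , v) * g (u , v)))) ⟩
    ΣF n (λ v → b2ℚ (v == b₂) * (𝟙ₐ (b₁ , v) * g (b₁ , v)))
      ≡⟨ ΣF-pick n b₂ (λ v → 𝟙ₐ (b₁ , v) * g (b₁ , v)) ⟩
    b2ℚ (adj b₁ b₂) * g (b₁ , b₂)
      ≡⟨ cong (λ e → b2ℚ e * g (b₁ , b₂)) (arc⇒true b-arc) ⟩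
    1ℚ * g (b₁ , b₂)
      ≡⟨ *-identityˡ (g (b₁ , b₂)) ⟩
    g (b₁ , b₂)
      ∎
    where
    factor : ∀ p q e y → e * (b2ℚ (p ∧ q) * y) ≡ b2ℚ p * (b2ℚ q * (e * y))
    factor p q e y = trans (cong (λ z → e * (z * y)) (b2ℚ-∧ p q))
      (solve 4 (λ P Q e y → e :* ((P :* Q) :* y) := P :* (Q :* (e :* y))) refl (b2ℚ p) (b2ℚ q) e y)

  infixr 5 _⊳_
  _⊳_ : Mat G → Vec → Vec
  M ⊳ x = _▷_ G M x

  ⊳-cong : ∀ M {x y} → x ≈ y → ∀ a → (M ⊳ x) a ≡ (M ⊳ y) a
  ⊳-cong M x≈y a = ΣA-cong (λ c c-arc → cong (M a c *_) (x≈y c c-arc))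

  ⊳-*ˡ : ∀ M c x a → (M ⊳ (λ b → c * x b)) a ≡ c * (M ⊳ x) a
  ⊳-*ˡ M c x a = trans (ΣA-cong (λ b _ → x∙yz≈y∙xz (M a b) c (x b))) (ΣA-*ˡ c (λ b → M a b * x b))

  ⊳-assoc : ∀ M M' x a → (_·_ G M M' ⊳ x) a ≡ (M ⊳ M' ⊳ x) a
  ⊳-assoc M M' x a = begin
    ΣA G (λ c → ΣA G (λ e → M a e * M' e c) * x c)   ≡⟨ ΣA-cong (λ c _ → ΣA-*ʳ (x c) (λ e → M a e * M' e c)) ⟨
    ΣA G (λ c → ΣA G (λ e → M a e * M' e c * x c))   ≡⟨ ΣA-comm (λ c e → M a e * M' e c * x c) ⟩
    ΣA G (λ e → ΣA G (λ c → M a e * M' e c * x c))   ≡⟨ ΣA-cong (λ e _ → trans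
                                                          (ΣA-cong (λ c _ → *-assoc (M a e) (M' e c) (x c)))
                                                          (ΣA-*ˡ (M a e) (λ c → M' e c * x c))) ⟩
    ΣA G (λ e → M a e * ΣA G (λ c → M' e c * x c))   ∎

  eqP-sym : ∀ a c → eqP G a c ≡ eqP G c a
  eqP-sym (a₁ , a₂) (c₁ , c₂) = cong₂ _∧_ (==-sym a₁ c₁) (==-sym a₂ c₂)

  idA-on-arcs : ∀ a c → IsArc G a → IsArc G c → idA G a c ≡ b2ℚ (eqP G c a)
  idA-on-arcs (a₁ , a₂) (c₁ , c₂) a-arc c-arc rewrite arc⇒true a-arc | arc⇒true c-arc =
    cong b2ℚ (eqP-sym (a₁ , a₂) (c₁ , c₂))

  S-on-arcs : ∀ a c → IsArc G a → IsArc G c → S G a c ≡ b2ℚ (eqP G c (inv G a))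
  S-on-arcs (a₁ , a₂) (c₁ , c₂) a-arc c-arc rewrite arc⇒true a-arc | arc⇒true c-arc =
    cong b2ℚ (trans (cong₂ _∧_ (==-sym a₁ c₂) (==-sym a₂ c₁)) (∧-comm (c₂ == a₁) (c₁ == a₂)))

  idA-⊳ : ∀ x → idA G ⊳ x ≈ x
  idA-⊳ x a a-arc =
    trans (ΣA-cong (λ c c-arc → cong (_* x c) (idA-on-arcs a c a-arc c-arc))) (ΣA-pick a a-arc x)

  S-⊳ : ∀ x → S G ⊳ x ≈ x ∘ inv G
  S-⊳ x a a-arc =
    trans (ΣA-cong (λ c c-arc → cong (_* x c) (S-on-arcs a c a-arc c-arc))) (ΣA-pick (inv G a) (inv-arc a a-arc) x)

  identity-⊳ : ∀ V → IsIdentity G V → ∀ x → V ⊳ x ≈ x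
  identity-⊳ V V≡I x a a-arc = trans (ΣA-cong (λ b b-arc → cong (_* x b) (V≡I a b a-arc b-arc))) (idA-⊳ x a a-arc)

  fixes-all⇒identity : ∀ V → (∀ x → V ⊳ x ≈ x) → IsIdentity G V
  fixes-all⇒identity V fixes-all a b a-arc b-arc = begin
    V a b                                    ≡⟨ ΣA-pick b b-arc (V a) ⟨
    ΣA G (λ c → b2ℚ (eqP G c b) * V a c)     ≡⟨ ΣA-cong (λ c c-arc → trans (*-comm (b2ℚ (eqP G c b)) (V a c))
                                                  (cong (V a c *_) (sym (trans (idA-on-arcs c b c-arc b-arc) (cong b2ℚ (eqP-sym b c)))))) ⟩
    (V ⊳ (λ c → idA G c b)) a                ≡⟨ fixes-all (λ c → idA G c b) a a-arc ⟩
    idA G a b                                ∎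

  ⟪_,_⟫ : Vec → Vec → ℚ
  ⟪ x , y ⟫ = ΣA G (λ a → x a * y a)

  ⟪⟫-cong : ∀ {x x' y y'} → x ≈ x' → y ≈ y' → ⟪ x , y ⟫ ≡ ⟪ x' , y' ⟫
  ⟪⟫-cong x≈x' y≈y' = ΣA-cong (λ a a-arc → cong₂ _*_ (x≈x' a a-arc) (y≈y' a a-arc))

  ⟪⟫-congˡ : ∀ {x x'} → x ≈ x' → ∀ y → ⟪ x , y ⟫ ≡ ⟪ x' , y ⟫
  ⟪⟫-congˡ x≈x' y = ΣA-cong (λ a a-arc → cong (_* y a) (x≈x' a a-arc))

  ⟪⟫-congʳ : ∀ x {y y'} → y ≈ y' → ⟪ x , y ⟫ ≡ ⟪ x , y' ⟫
  ⟪⟫-congʳ x y≈y' = ΣA-cong (λ a a-arc → cong (x a *_) (y≈y' a a-arc))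

  ⟪⟫-comm : ∀ x y → ⟪ x , y ⟫ ≡ ⟪ y , x ⟫
  ⟪⟫-comm x y = ΣA-cong (λ a _ → *-comm (x a) (y a))

  ⟪⟫-*ˡ : ∀ c x y → ⟪ (λ a → c * x a) , y ⟫ ≡ c * ⟪ x , y ⟫
  ⟪⟫-*ˡ c x y = trans (ΣA-cong (λ a _ → *-assoc c (x a) (y a))) (ΣA-*ˡ c (λ a → x a * y a))

  ⟪⟫-*ʳ : ∀ c x y → ⟪ x , (λ a → c * y a) ⟫ ≡ c * ⟪ x , y ⟫
  ⟪⟫-*ʳ c x y = trans (⟪⟫-comm x (λ a → c * y a)) (trans (⟪⟫-*ˡ c y x) (cong (c *_) (⟪⟫-comm y x)))

  ⟪⟫-−ˡ : ∀ x y z → ⟪ (λ a → x a - y a) , z ⟫ ≡ ⟪ x , z ⟫ - ⟪ y , z ⟫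
  ⟪⟫-−ˡ x y z = trans (ΣA-cong (λ a _ → distrib (x a) (y a) (z a))) (ΣA-- (λ a → x a * z a) (λ a → y a * z a))
    where
    distrib : ∀ x y z → (x - y) * z ≡ x * z - y * z
    distrib = solve 3 (λ x y z → (x :- y) :* z := x :* z :- y :* z) refl

  ⟪⟫-−ʳ : ∀ e x y → ⟪ e , (λ a → x a - y a) ⟫ ≡ ⟪ e , x ⟫ - ⟪ e , y ⟫
  ⟪⟫-−ʳ e x y = trans (ΣA-cong (λ a _ → distrib (e a) (x a) (y a))) (ΣA-- (λ a → e a * x a) (λ a → e a * y a))
    where
    distrib : ∀ e x y → e * (x - y) ≡ e * x - e * y
    distrib = solve 3 (λ e x y → e :* (x :- y) := e :* x :- e :* y) refl

  ⟪⟫-expand : ∀ t p q x y → ⟪ (λ a → t * p a - x a) , (λ a → t * q a - y a) ⟫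
                          ≡ ⟪ x , y ⟫ + t * ((t * ⟪ p , q ⟫ - ⟪ p , y ⟫) - ⟪ q , x ⟫)
  ⟪⟫-expand t p q x y = begin
    ΣA G (λ a → (t * p a - x a) * (t * q a - y a))
      ≡⟨ ΣA-cong (λ a _ → expand (p a) (q a) (x a) (y a)) ⟩
    ΣA G (λ a → x a * y a + t * ((t * (p a * q a) - p a * y a) - q a * x a))
      ≡⟨ ΣA-+ (λ a → x a * y a) (λ a → t * ((t * (p a * q a) - p a * y a) - q a * x a)) ⟩
    ⟪ x , y ⟫ + ΣA G (λ a → t * ((t * (p a * q a) - p a * y a) - q a * x a))
      ≡⟨ cong (⟪ x , y ⟫ +_) (ΣA-*ˡ t (λ a → (t * (p a * q a) - p a * y a) - q a * x a)) ⟩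
    ⟪ x , y ⟫ + t * ΣA G (λ a → (t * (p a * q a) - p a * y a) - q a * x a)
      ≡⟨ cong (λ s → ⟪ x , y ⟫ + t * s) (ΣA-- (λ a → t * (p a * q a) - p a * y a) (λ a → q a * x a)) ⟩
    ⟪ x , y ⟫ + t * (ΣA G (λ a → t * (p a * q a) - p a * y a) - ⟪ q , x ⟫)
      ≡⟨ cong (λ s → ⟪ x , y ⟫ + t * (s - ⟪ q , x ⟫)) (ΣA-- (λ a → t * (p a * q a)) (λ a → p a * y a)) ⟩
    ⟪ x , y ⟫ + t * ((ΣA G (λ a → t * (p a * q a)) - ⟪ p , y ⟫) - ⟪ q , x ⟫)
      ≡⟨ cong (λ s → ⟪ x , y ⟫ + t * ((s - ⟪ p , y ⟫) - ⟪ q , x ⟫)) (ΣA-*ˡ t (λ a → p a * q a)) ⟩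
    ⟪ x , y ⟫ + t * ((t * ⟪ p , q ⟫ - ⟪ p , y ⟫) - ⟪ q , x ⟫)
      ∎
    where
    expand : ∀ p q x y → (t * p - x) * (t * q - y) ≡ x * y + t * ((t * (p * q) - p * y) - q * x)
    expand p q x y = solve 5 (λ t p q x y → (t :* p :- x) :* (t :* q :- y)
                               := x :* y :+ t :* ((t :* (p :* q) :- p :* y) :- q :* x)) refl t p q x y

  S-orthogonal : ∀ x y → ⟪ S G ⊳ x , S G ⊳ y ⟫ ≡ ⟪ x , y ⟫
  S-orthogonal x y = trans (⟪⟫-cong (S-⊳ x) (S-⊳ y)) (ΣA-inv (λ a → x a * y a))

  ⟪⟫-definite : ∀ z → ⟪ z , z ⟫ ≡ 0ℚ → z ≈ λ _ → 0ℚ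
  ⟪⟫-definite z ⟪z,z⟫≡0 (u , v) uv-arc = square-zero (z (u , v)) (begin
    z (u , v) * z (u , v)                          ≡⟨ *-identityˡ (z (u , v) * z (u , v)) ⟨
    1ℚ * (z (u , v) * z (u , v))                   ≡⟨ cong (λ e → b2ℚ e * (z (u , v) * z (u , v))) (arc⇒true uv-arc) ⟨
    b2ℚ (adj u v) * (z (u , v) * z (u , v))        ≡⟨ ΣF-nonneg-zero n (row u) (row-nonneg u) row-u≡0 v ⟩
    0ℚ                                             ∎)
    where
    row : Fin n → Fin n → ℚ
    row u v = b2ℚ (adj u v) * (z (u , v) * z (u , v))
    row-nonneg : ∀ u v → 0ℚ ≤ row u v
    row-nonneg u v with adj u v
    ... | true  = subst (0ℚ ≤_) (sym (*-identityˡ (z (u , v) * z (u , v)))) (square-nonneg (z (u , v)))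
    ... | false = subst (0ℚ ≤_) (sym (*-zeroˡ (z (u , v) * z (u , v)))) ≤-refl
    row-u≡0 : ΣF n (row u) ≡ 0ℚ
    row-u≡0 = ΣF-nonneg-zero n (λ u → ΣF n (row u)) (λ u → ΣF-nonneg n (row u) (row-nonneg u)) ⟪z,z⟫≡0 u

  ≈-by-inner : ∀ x y → ⟪ x , x ⟫ ≡ ⟪ y , y ⟫ → ⟪ y , x ⟫ ≡ ⟪ y , y ⟫ → x ≈ y
  ≈-by-inner x y ⟪x,x⟫≡⟪y,y⟫ ⟪y,x⟫≡⟪y,y⟫ a a-arc =
    x∙y⁻¹≈ε⇒x≈y (x a) (y a) (⟪⟫-definite x-y ⟪x-y,x-y⟫≡0 a a-arc)
    where
    x-y : Vec
    x-y a = x a - y a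
    ⟪x-y,x-y⟫≡0 : ⟪ x-y , x-y ⟫ ≡ 0ℚ
    ⟪x-y,x-y⟫≡0 = begin
      ⟪ x-y , x-y ⟫                                        ≡⟨ ⟪⟫-−ˡ x y x-y ⟩
      ⟪ x , x-y ⟫ - ⟪ y , x-y ⟫                            ≡⟨ cong₂ _-_ (⟪⟫-−ʳ x x y) (⟪⟫-−ʳ y x y) ⟩
      (⟪ x , x ⟫ - ⟪ x , y ⟫) - (⟪ y , x ⟫ - ⟪ y , y ⟫)    ≡⟨ cong (λ s → (⟪ x , x ⟫ - s) - (⟪ y , x ⟫ - ⟪ y , y ⟫)) (⟪⟫-comm x y) ⟩
      (⟪ x , x ⟫ - ⟪ y , x ⟫) - (⟪ y , x ⟫ - ⟪ y , y ⟫)    ≡⟨ cong₂ (λ p q → (p - q) - (q - ⟪ y , y ⟫)) ⟪x,x⟫≡⟪y,y⟫ ⟪y,x⟫≡⟪y,y⟫ ⟩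
      (⟪ y , y ⟫ - ⟪ y , y ⟫) - (⟪ y , y ⟫ - ⟪ y , y ⟫)    ≡⟨ cong₂ _-_ (+-inverseʳ ⟪ y , y ⟫) (+-inverseʳ ⟪ y , y ⟫) ⟩
      0ℚ - 0ℚ                                              ≡⟨ +-inverseʳ 0ℚ ⟩
      0ℚ                                                   ∎

  -- The vectors of N*ℚ^V + S N*ℚ^V, the span of the χ w and ψ w = S ⊳ χ w.
  endpointVec : (Fin n → ℚ) → (Fin n → ℚ) → Vec
  endpointVec α β (s , t) = α t + β s

  InEndpointSpan : Vec → Set
  InEndpointSpan z = Σ[ α ∈ (Fin n → ℚ) ] Σ[ β ∈ (Fin n → ℚ) ] z ≈ endpointVec α β

  InEndpointSpan-cong : ∀ {y z} → y ≈ z → InEndpointSpan y → InEndpointSpan z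
  InEndpointSpan-cong y≈z (α , β , y≈) = α , β , λ a a-arc → trans (sym (y≈z a a-arc)) (y≈ a a-arc)

  InEndpointSpan-+ : ∀ {y z} → InEndpointSpan y → InEndpointSpan z → InEndpointSpan (λ a → y a + z a)
  InEndpointSpan-+ (α , β , y≈) (α' , β' , z≈) =
      (λ t → α t + α' t) , (λ s → β s + β' s)
    , λ a a-arc → trans (cong₂ _+_ (y≈ a a-arc) (z≈ a a-arc)) (interchange (α (proj₂ a)) (β (proj₁ a)) (α' (proj₂ a)) (β' (proj₁ a)))
    where
    interchange : ∀ a b c d → (a + b) + (c + d) ≡ (a + c) + (b + d)
    interchange = solve 4 (λ a b c d → (a :+ b) :+ (c :+ d) := (a :+ c) :+ (b :+ d)) refl

  ⟪endpointVec,⟫ : ∀ α β z → ⟪ endpointVec α β , z ⟫ ≡ ΣF n (λ w → α w * inflow z w) + ΣF n (λ w → β w * outflow z w)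
  ⟪endpointVec,⟫ α β z = begin
    ΣA G (λ a → (α (proj₂ a) + β (proj₁ a)) * z a)
      ≡⟨ ΣA-cong (λ a _ → *-distribʳ-+ (z a) (α (proj₂ a)) (β (proj₁ a))) ⟩
    ΣA G (λ a → α (proj₂ a) * z a + β (proj₁ a) * z a)
      ≡⟨ ΣA-+ (λ a → α (proj₂ a) * z a) (λ a → β (proj₁ a) * z a) ⟩
    ΣA G (λ a → α (proj₂ a) * z a) + ΣA G (λ a → β (proj₁ a) * z a)
      ≡⟨ cong₂ _+_ (ΣA-byTarget α z) (ΣA-bySource β z) ⟩
    ΣF n (λ w → α w * inflow z w) + ΣF n (λ w → β w * outflow z w)
      ∎

  χ-on-arcs : ∀ w → χ G w ≈ λ a → b2ℚ (tgt G a == w)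
  χ-on-arcs w (s , t) st-arc = cong (λ b → b2ℚ (b ∧ (t == w))) (arc⇒true st-arc)

  χ≈endpointVec : ∀ w → χ G w ≈ endpointVec (λ t → b2ℚ (t == w)) (λ _ → 0ℚ)
  χ≈endpointVec w (s , t) st-arc = trans (χ-on-arcs w (s , t) st-arc) (sym (+-identityʳ (b2ℚ (t == w))))

  ψ : Fin n → Vec
  ψ w a = b2ℚ (proj₁ a == w)

  ⟪χ,⟫ : ∀ w z → ⟪ χ G w , z ⟫ ≡ inflow z w
  ⟪χ,⟫ w z = begin
    ⟪ χ G w , z ⟫                                   ≡⟨ ⟪⟫-congˡ (λ a a-arc → trans (χ≈endpointVec w a a-arc)
                                                          (+-identityʳ (b2ℚ (proj₂ a == w)))) z ⟩
    ΣA G (λ a → b2ℚ (tgt G a == w) * z a)           ≡⟨ ΣA-byTarget (λ t → b2ℚ (t == w)) z ⟩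
    ΣF n (λ t → b2ℚ (t == w) * inflow z t)          ≡⟨ ΣF-pick n w (inflow z) ⟩
    inflow z w                                      ∎

  ⟪ψ,⟫ : ∀ w z → ⟪ ψ w , z ⟫ ≡ outflow z w
  ⟪ψ,⟫ w z = trans (ΣA-bySource (λ s → b2ℚ (s == w)) z) (ΣF-pick n w (outflow z))

  InEndpointSpan-⊥⇒≈0 : ∀ z → InEndpointSpan z → (∀ w → ⟪ χ G w , z ⟫ ≡ 0ℚ) → (∀ w → ⟪ ψ w , z ⟫ ≡ 0ℚ) →
                        z ≈ λ _ → 0ℚ
  InEndpointSpan-⊥⇒≈0 z (α , β , z≈) χ⊥z ψ⊥z = ⟪⟫-definite z (begin
    ⟪ z , z ⟫                                                         ≡⟨ ⟪⟫-congˡ z≈ z ⟩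
    ⟪ endpointVec α β , z ⟫                                           ≡⟨ ⟪endpointVec,⟫ α β z ⟩
    ΣF n (λ w → α w * inflow z w) + ΣF n (λ w → β w * outflow z w)    ≡⟨ cong₂ _+_
                                                                           (Σ*0 α (λ w → trans (sym (⟪χ,⟫ w z)) (χ⊥z w)))
                                                                           (Σ*0 β (λ w → trans (sym (⟪ψ,⟫ w z)) (ψ⊥z w))) ⟩
    0ℚ + 0ℚ                                                           ≡⟨ +-identityˡ 0ℚ ⟩
    0ℚ                                                                ∎)
    where
    Σ*0 : ∀ (γ : Fin n → ℚ) {f : Fin n → ℚ} → (∀ w → f w ≡ 0ℚ) → ΣF n (λ w → γ w * f w) ≡ 0ℚ
    Σ*0 γ f≡0 = trans (ΣF-cong n (λ w → trans (cong (γ w *_) (f≡0 w)) (*-zeroʳ (γ w)))) (ΣF-zero n)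

module GroverWalk {n : ℕ} (G : Graph n) (k : ℕ) .⦃ k≢0 : ℕ.NonZero k ⦄
                  (regular : ∀ w → deg G w ≡ k) where

  import Data.Integer as ℤ
  import Data.Nat.Properties as ℕ
  open import Data.Rational using (ℚ; 0ℚ; 1ℚ; _+_; _*_; _-_; -_; _/_)
  open import Data.Rational.Properties
  open import Data.Rational.Solver using (module +-*-Solver)
  open +-*-Solver
  open import Algebra.Bundles using (CommutativeMonoid)
  open import Algebra.Properties.CommutativeSemigroup (CommutativeMonoid.commutativeSemigroup *-1-commutativeMonoid)
    using (x∙yz≈y∙xz)
  open import Algebra.Properties.Group +-0-group using (x∙y⁻¹≈ε⇒x≈y)
  open Graph G
  open Indicators
  open FiniteSums
  open Counting
  open ArcSpace G public
  open ≡-Reasoning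

  kℚ : ℚ
  kℚ = fromℕ k

  k⁻¹ : ℚ
  k⁻¹ = recip G k

  k⁻¹*k≡1 : k⁻¹ * kℚ ≡ 1ℚ
  k⁻¹*k≡1 = inverse k
    where
    inverse : ∀ m .⦃ _ : ℕ.NonZero m ⦄ → recip G m * fromℕ m ≡ 1ℚ
    inverse (suc m) = 1/suc-inverse m

  in-degree : ∀ w → ΣF n (λ u → b2ℚ (adj u w)) ≡ kℚ
  in-degree w = begin
    ΣF n (λ u → b2ℚ (adj u w))   ≡⟨ ΣF-cong n (λ u → cong b2ℚ (symmetric u w)) ⟩
    ΣF n (b2ℚ ∘ adj w)           ≡⟨ ΣF-count n (adj w) ⟩
    fromℕ (deg G w)              ≡⟨ cong fromℕ (regular w) ⟩
    kℚ                           ∎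

  NstarN-on-arcs : ∀ b c → IsArc G b → IsArc G c → NstarN G b c ≡ b2ℚ (tgt G c == tgt G b) * k⁻¹
  NstarN-on-arcs (b₁ , b₂) (c₁ , c₂) b-arc c-arc rewrite arc⇒true b-arc | arc⇒true c-arc | regular b₂ =
    cong (λ e → b2ℚ e * k⁻¹) (==-sym b₂ c₂)

  mean : Vec → Vec
  mean x b = k⁻¹ * inflow x (tgt G b)

  NstarN-⊳ : ∀ x → NstarN G ⊳ x ≈ mean x
  NstarN-⊳ x b b-arc = begin
    ΣA G (λ c → NstarN G b c * x c)
      ≡⟨ ΣA-cong (λ c c-arc → trans (cong (_* x c) (NstarN-on-arcs b c b-arc c-arc))
                                     (*-assoc (b2ℚ (tgt G c == tgt G b)) k⁻¹ (x c))) ⟩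
    ΣA G (λ c → b2ℚ (tgt G c == tgt G b) * (k⁻¹ * x c))
      ≡⟨ ΣA-byTarget (λ w → b2ℚ (w == tgt G b)) (λ c → k⁻¹ * x c) ⟩
    ΣF n (λ w → b2ℚ (w == tgt G b) * inflow (λ c → k⁻¹ * x c) w)
      ≡⟨ ΣF-pick n (tgt G b) (inflow (λ c → k⁻¹ * x c)) ⟩
    inflow (λ c → k⁻¹ * x c) (tgt G b)
      ≡⟨ inflow-*ˡ k⁻¹ x (tgt G b) ⟩
    mean x b
      ∎

  two : ℚ
  two = ℤ.+ 2 / 1

  K-⊳ : ∀ x → K G ⊳ x ≈ λ b → two * mean x b - x b
  K-⊳ x b b-arc = begin
    ΣA G (λ c → (two * NstarN G b c - idA G b c) * x c)
      ≡⟨ ΣA-cong (λ c _ → distrib two (NstarN G b c) (idA G b c) (x c)) ⟩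
    ΣA G (λ c → two * (NstarN G b c * x c) - idA G b c * x c)
      ≡⟨ ΣA-- (λ c → two * (NstarN G b c * x c)) (λ c → idA G b c * x c) ⟩
    ΣA G (λ c → two * (NstarN G b c * x c)) - (idA G ⊳ x) b
      ≡⟨ cong (_- (idA G ⊳ x) b) (ΣA-*ˡ two (λ c → NstarN G b c * x c)) ⟩
    two * (NstarN G ⊳ x) b - (idA G ⊳ x) b
      ≡⟨ cong₂ (λ p q → two * p - q) (NstarN-⊳ x b b-arc) (idA-⊳ x b b-arc) ⟩
    two * mean x b - x b
      ∎
    where
    distrib : ∀ t m i y → (t * m - i) * y ≡ t * (m * y) - i * y
    distrib = solve 4 (λ t m i y → (t :* m :- i) :* y := t :* (m :* y) :- i :* y) refl

  U-⊳ : ∀ x → U G ⊳ x ≈ λ a → two * mean x (inv G a) - x (inv G a)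
  U-⊳ x a a-arc = begin
    (U G ⊳ x) a            ≡⟨ ⊳-assoc (S G) (K G) x a ⟩
    (S G ⊳ K G ⊳ x) a      ≡⟨ S-⊳ (K G ⊳ x) a a-arc ⟩
    (K G ⊳ x) (inv G a)    ≡⟨ K-⊳ x (inv G a) (inv-arc a a-arc) ⟩
    two * mean x (inv G a) - x (inv G a) ∎

  inflow-mean : ∀ x w → inflow (mean x) w ≡ inflow x w
  inflow-mean x w = begin
    ΣF n (λ u → b2ℚ (adj u w) * (k⁻¹ * inflow x w))   ≡⟨ ΣF-*ʳ n (k⁻¹ * inflow x w) (λ u → b2ℚ (adj u w)) ⟩
    ΣF n (λ u → b2ℚ (adj u w)) * (k⁻¹ * inflow x w)   ≡⟨ cong (_* (k⁻¹ * inflow x w)) (in-degree w) ⟩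
    kℚ * (k⁻¹ * inflow x w)                           ≡⟨ x∙yz≈y∙xz kℚ k⁻¹ (inflow x w) ⟩
    k⁻¹ * (kℚ * inflow x w)                           ≡⟨ *-assoc k⁻¹ kℚ (inflow x w) ⟨
    k⁻¹ * kℚ * inflow x w                             ≡⟨ cong (_* inflow x w) k⁻¹*k≡1 ⟩
    1ℚ * inflow x w                                   ≡⟨ *-identityˡ (inflow x w) ⟩
    inflow x w                                        ∎

  ⟪mean,mean⟫ : ∀ x y → ⟪ mean x , mean y ⟫ ≡ ⟪ mean x , y ⟫
  ⟪mean,mean⟫ x y = begin
    ⟪ mean x , mean y ⟫                       ≡⟨ ΣA-byTarget X (mean y) ⟩
    ΣF n (λ w → X w * inflow (mean y) w)      ≡⟨ ΣF-cong n (λ w → cong (X w *_) (inflow-mean y w)) ⟩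
    ΣF n (λ w → X w * inflow y w)             ≡⟨ ΣA-byTarget X y ⟨
    ⟪ mean x , y ⟫                            ∎
    where
    X : Fin n → ℚ
    X w = k⁻¹ * inflow x w

  -- K = 2 N*N − I is a reflection because mean = N*N is an orthogonal projection.
  K-orthogonal : ∀ x y → ⟪ K G ⊳ x , K G ⊳ y ⟫ ≡ ⟪ x , y ⟫
  K-orthogonal x y = begin
    ⟪ K G ⊳ x , K G ⊳ y ⟫                                              ≡⟨ ⟪⟫-cong (K-⊳ x) (K-⊳ y) ⟩
    ⟪ (λ b → two * p b - x b) , (λ b → two * q b - y b) ⟫              ≡⟨ ⟪⟫-expand two p q x y ⟩
    ⟪ x , y ⟫ + two * ((two * ⟪ p , q ⟫ - ⟪ p , y ⟫) - ⟪ q , x ⟫)      ≡⟨ cong₂ (λ s t → ⟪ x , y ⟫ + two * ((two * ⟪ p , q ⟫ - s) - t))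
                                                                            ⟪p,y⟫≡⟪p,q⟫ ⟪q,x⟫≡⟪p,q⟫ ⟩
    ⟪ x , y ⟫ + two * ((two * ⟪ p , q ⟫ - ⟪ p , q ⟫) - ⟪ p , q ⟫)      ≡⟨ cancel ⟪ x , y ⟫ ⟪ p , q ⟫ ⟩
    ⟪ x , y ⟫                                                          ∎
    where
    p q : Vec
    p = mean x
    q = mean y
    ⟪p,y⟫≡⟪p,q⟫ : ⟪ p , y ⟫ ≡ ⟪ p , q ⟫
    ⟪p,y⟫≡⟪p,q⟫ = sym (⟪mean,mean⟫ x y)
    ⟪q,x⟫≡⟪p,q⟫ : ⟪ q , x ⟫ ≡ ⟪ p , q ⟫
    ⟪q,x⟫≡⟪p,q⟫ = trans (sym (⟪mean,mean⟫ y x)) (⟪⟫-comm q p)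
    cancel : ∀ a s → a + two * ((two * s - s) - s) ≡ a
    cancel = solve 2 (λ a s → a :+ con two :* ((con two :* s :- s) :- s) := a) refl

  U-orthogonal : ∀ x y → ⟪ U G ⊳ x , U G ⊳ y ⟫ ≡ ⟪ x , y ⟫
  U-orthogonal x y = begin
    ⟪ U G ⊳ x , U G ⊳ y ⟫                    ≡⟨ ⟪⟫-cong (λ a _ → ⊳-assoc (S G) (K G) x a) (λ a _ → ⊳-assoc (S G) (K G) y a) ⟩
    ⟪ S G ⊳ K G ⊳ x , S G ⊳ K G ⊳ y ⟫        ≡⟨ S-orthogonal (K G ⊳ x) (K G ⊳ y) ⟩
    ⟪ K G ⊳ x , K G ⊳ y ⟫                    ≡⟨ K-orthogonal x y ⟩
    ⟪ x , y ⟫                                ∎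

  infix 8 U^_
  U^_ : ℕ → Mat G
  U^ t = _^_ G (U G) t

  U^-one : ∀ x → U^ 1 ⊳ x ≈ U G ⊳ x
  U^-one x a _ = trans (⊳-assoc (U G) (idA G) x a) (⊳-cong (U G) (idA-⊳ x) a)

  U^-+ : ∀ i j x → U^ (i ℕ.+ j) ⊳ x ≈ U^ i ⊳ U^ j ⊳ x
  U^-+ zero    j x a a-arc = sym (idA-⊳ (U^ j ⊳ x) a a-arc)
  U^-+ (suc i) j x a a-arc = begin
    (U^ suc (i ℕ.+ j) ⊳ x) a       ≡⟨ ⊳-assoc (U G) (U^ (i ℕ.+ j)) x a ⟩
    (U G ⊳ U^ (i ℕ.+ j) ⊳ x) a     ≡⟨ ⊳-cong (U G) (U^-+ i j x) a ⟩
    (U G ⊳ U^ i ⊳ U^ j ⊳ x) a      ≡⟨ ⊳-assoc (U G) (U^ i) (U^ j ⊳ x) a ⟨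
    (U^ suc i ⊳ U^ j ⊳ x) a        ∎

  U^-orthogonal : ∀ t x y → ⟪ U^ t ⊳ x , U^ t ⊳ y ⟫ ≡ ⟪ x , y ⟫
  U^-orthogonal zero    x y = ⟪⟫-cong (idA-⊳ x) (idA-⊳ y)
  U^-orthogonal (suc t) x y = begin
    ⟪ U^ suc t ⊳ x , U^ suc t ⊳ y ⟫        ≡⟨ ⟪⟫-cong (λ a _ → ⊳-assoc (U G) (U^ t) x a) (λ a _ → ⊳-assoc (U G) (U^ t) y a) ⟩
    ⟪ U G ⊳ U^ t ⊳ x , U G ⊳ U^ t ⊳ y ⟫    ≡⟨ U-orthogonal (U^ t ⊳ x) (U^ t ⊳ y) ⟩
    ⟪ U^ t ⊳ x , U^ t ⊳ y ⟫                ≡⟨ U^-orthogonal t x y ⟩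
    ⟪ x , y ⟫                              ∎

  U²-sub-id : ∀ x → InEndpointSpan (λ a → (U G ⊳ U G ⊳ x) a - x a)
  U²-sub-id x = (λ t → - (two * (k⁻¹ * inflow x t))) , (λ s → two * (k⁻¹ * inflow (U G ⊳ x) s)) , U²x-x≈
    where
    rearrange : ∀ b c x → (b - (c - x)) - x ≡ - c + b
    rearrange = solve 3 (λ b c x → (b :- (c :- x)) :- x := :- c :+ b) refl
    U²x-x≈ : (λ a → (U G ⊳ U G ⊳ x) a - x a)
           ≈ endpointVec (λ t → - (two * (k⁻¹ * inflow x t))) (λ s → two * (k⁻¹ * inflow (U G ⊳ x) s))
    U²x-x≈ a a-arc = begin
      (U G ⊳ U G ⊳ x) a - x a
        ≡⟨ cong (_- x a) (U-⊳ (U G ⊳ x) a a-arc) ⟩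
      (two * mean (U G ⊳ x) (inv G a) - (U G ⊳ x) (inv G a)) - x a
        ≡⟨ cong (λ e → (two * mean (U G ⊳ x) (inv G a) - e) - x a) (U-⊳ x (inv G a) (inv-arc a a-arc)) ⟩
      (two * mean (U G ⊳ x) (inv G a) - (two * mean x a - x a)) - x a
        ≡⟨ rearrange (two * mean (U G ⊳ x) (inv G a)) (two * mean x a) (x a) ⟩
      - (two * mean x a) + two * mean (U G ⊳ x) (inv G a)
        ∎

  U^[m+m]-sub-id : ∀ m x → InEndpointSpan (λ a → (U^ (m ℕ.+ m) ⊳ x) a - x a)
  U^[m+m]-sub-id zero    x = (λ _ → 0ℚ) , (λ _ → 0ℚ) , λ a a-arc →
    trans (cong (_- x a) (idA-⊳ x a a-arc)) (trans (+-inverseʳ (x a)) (sym (+-identityʳ 0ℚ)))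
  U^[m+m]-sub-id (suc m) x =
    InEndpointSpan-cong telescope (InEndpointSpan-+ (U²-sub-id y) (U^[m+m]-sub-id m x))
    where
    y : Vec
    y = U^ (m ℕ.+ m) ⊳ x
    U^[2+m+m]≈U²U^[m+m] : U^ (suc m ℕ.+ suc m) ⊳ x ≈ U G ⊳ U G ⊳ y
    U^[2+m+m]≈U²U^[m+m] a a-arc = begin
      (U^ (suc m ℕ.+ suc m) ⊳ x) a     ≡⟨ cong (λ t → (U^ suc t ⊳ x) a) (ℕ.+-suc m m) ⟩
      (U^ (2 ℕ.+ (m ℕ.+ m)) ⊳ x) a     ≡⟨ U^-+ 2 (m ℕ.+ m) x a a-arc ⟩
      (U^ 2 ⊳ y) a                     ≡⟨ ⊳-assoc (U G) (U^ 1) y a ⟩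
      (U G ⊳ U^ 1 ⊳ y) a               ≡⟨ ⊳-cong (U G) (U^-one y) a ⟩
      (U G ⊳ U G ⊳ y) a                ∎
    telescope : (λ a → ((U G ⊳ U G ⊳ y) a - y a) + (y a - x a)) ≈ (λ a → (U^ (suc m ℕ.+ suc m) ⊳ x) a - x a)
    telescope a a-arc = trans
      (solve 3 (λ v w x → (v :- w) :+ (w :- x) := v :- x) refl ((U G ⊳ U G ⊳ y) a) (y a) (x a))
      (cong (_- x a) (sym (U^[2+m+m]≈U²U^[m+m] a a-arc)))

  adjacencySum : (Fin n → ℚ) → Fin n → ℚ
  adjacencySum β s = ΣF n (λ u → b2ℚ (adj s u) * β u)

  adjacencySum-zero : ∀ s → adjacencySum (λ _ → 0ℚ) s ≡ 0ℚ
  adjacencySum-zero s = trans (ΣF-cong n (λ u → *-zeroʳ (b2ℚ (adj s u)))) (ΣF-zero n)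

  inflow-endpointVec : ∀ α β z → z ≈ endpointVec α β → ∀ s → inflow z s ≡ kℚ * α s + adjacencySum β s
  inflow-endpointVec α β z z≈ s = begin
    inflow z s
      ≡⟨ inflow-cong z≈ s ⟩
    ΣF n (λ u → b2ℚ (adj u s) * (α s + β u))
      ≡⟨ ΣF-cong n (λ u → *-distribˡ-+ (b2ℚ (adj u s)) (α s) (β u)) ⟩
    ΣF n (λ u → b2ℚ (adj u s) * α s + b2ℚ (adj u s) * β u)
      ≡⟨ ΣF-+ n (λ u → b2ℚ (adj u s) * α s) (λ u → b2ℚ (adj u s) * β u) ⟩
    ΣF n (λ u → b2ℚ (adj u s) * α s) + ΣF n (λ u → b2ℚ (adj u s) * β u)
      ≡⟨ cong₂ _+_ (trans (ΣF-*ʳ n (α s) (λ u → b2ℚ (adj u s))) (cong (_* α s) (in-degree s)))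
                   (ΣF-cong n (λ u → cong (λ e → b2ℚ e * β u) (symmetric u s))) ⟩
    kℚ * α s + adjacencySum β s
      ∎

  U-endpointVec : ∀ α β z → z ≈ endpointVec α β →
                  U G ⊳ z ≈ endpointVec (λ t → - β t) (λ s → α s + two * (k⁻¹ * adjacencySum β s))
  U-endpointVec α β z z≈ (s , t) st-arc = begin
    (U G ⊳ z) (s , t)
      ≡⟨ U-⊳ z (s , t) st-arc ⟩
    two * (k⁻¹ * inflow z s) - z (t , s)
      ≡⟨ cong₂ (λ i e → two * (k⁻¹ * i) - e) (inflow-endpointVec α β z z≈ s) (z≈ (t , s) (inv-arc (s , t) st-arc)) ⟩
    two * (k⁻¹ * (kℚ * α s + adjacencySum β s)) - (α s + β t)
      ≡⟨ cong (λ e → two * e - (α s + β t)) (k⁻¹-cancel (α s) (adjacencySum β s)) ⟩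
    two * (α s + k⁻¹ * adjacencySum β s) - (α s + β t)
      ≡⟨ rearrange (α s) (β t) (k⁻¹ * adjacencySum β s) ⟩
    - β t + (α s + two * (k⁻¹ * adjacencySum β s))
      ∎
    where
    k⁻¹-cancel : ∀ a b → k⁻¹ * (kℚ * a + b) ≡ a + k⁻¹ * b
    k⁻¹-cancel a b = begin
      k⁻¹ * (kℚ * a + b)        ≡⟨ solve 4 (λ r k a b → r :* (k :* a :+ b) := r :* k :* a :+ r :* b) refl k⁻¹ kℚ a b ⟩
      k⁻¹ * kℚ * a + k⁻¹ * b    ≡⟨ cong (λ e → e * a + k⁻¹ * b) k⁻¹*k≡1 ⟩
      1ℚ * a + k⁻¹ * b          ≡⟨ cong (_+ k⁻¹ * b) (*-identityˡ a) ⟩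
      a + k⁻¹ * b               ∎
    rearrange : ∀ a b c → two * (a + c) - (a + b) ≡ - b + (a + two * c)
    rearrange = solve 3 (λ a b c → con two :* (a :+ c) :- (a :+ b) := :- b :+ (a :+ con two :* c)) refl

  U-χ : ∀ w → U G ⊳ χ G w ≈ ψ w
  U-χ w (s , t) st-arc = begin
    (U G ⊳ χ G w) (s , t)
      ≡⟨ U-endpointVec (λ t → b2ℚ (t == w)) (λ _ → 0ℚ) (χ G w) (χ≈endpointVec w) (s , t) st-arc ⟩
    - 0ℚ + (b2ℚ (s == w) + two * (k⁻¹ * adjacencySum (λ _ → 0ℚ) s))
      ≡⟨ cong (λ e → - 0ℚ + (b2ℚ (s == w) + two * (k⁻¹ * e))) (adjacencySum-zero s) ⟩
    - 0ℚ + (b2ℚ (s == w) + two * (k⁻¹ * 0ℚ))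
      ≡⟨ solve 2 (λ δ r → :- con 0ℚ :+ (δ :+ con two :* (r :* con 0ℚ)) := δ) refl (b2ℚ (s == w)) k⁻¹ ⟩
    b2ℚ (s == w)
      ∎

  ⟪χ,χ⟫ : ∀ y w → ⟪ χ G y , χ G w ⟫ ≡ kℚ * b2ℚ (y == w)
  ⟪χ,χ⟫ y w = begin
    ⟪ χ G y , χ G w ⟫                                    ≡⟨ ⟪χ,⟫ y (χ G w) ⟩
    inflow (χ G w) y                                     ≡⟨ inflow-endpointVec (λ t → b2ℚ (t == w)) (λ _ → 0ℚ) (χ G w) (χ≈endpointVec w) y ⟩
    kℚ * b2ℚ (y == w) + adjacencySum (λ _ → 0ℚ) y        ≡⟨ cong (kℚ * b2ℚ (y == w) +_) (adjacencySum-zero y) ⟩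
    kℚ * b2ℚ (y == w) + 0ℚ                               ≡⟨ +-identityʳ (kℚ * b2ℚ (y == w)) ⟩
    kℚ * b2ℚ (y == w)                                    ∎

  fixed⊥U^-sub-id : ∀ t e x → U^ t ⊳ e ≈ e → ⟪ e , (λ a → (U^ t ⊳ x) a - x a) ⟫ ≡ 0ℚ
  fixed⊥U^-sub-id t e x fixes-e = begin
    ⟪ e , (λ a → (U^ t ⊳ x) a - x a) ⟫     ≡⟨ ⟪⟫-−ʳ e (U^ t ⊳ x) x ⟩
    ⟪ e , U^ t ⊳ x ⟫ - ⟪ e , x ⟫           ≡⟨ cong (_- ⟪ e , x ⟫) (⟪⟫-congˡ (λ a a-arc → sym (fixes-e a a-arc)) (U^ t ⊳ x)) ⟩
    ⟪ U^ t ⊳ e , U^ t ⊳ x ⟫ - ⟪ e , x ⟫    ≡⟨ cong (_- ⟪ e , x ⟫) (U^-orthogonal t e x) ⟩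
    ⟪ e , x ⟫ - ⟪ e , x ⟫                  ≡⟨ +-inverseʳ ⟪ e , x ⟫ ⟩
    0ℚ                                     ∎

  fixes-χ⇒fixes-ψ : ∀ t w → U^ t ⊳ χ G w ≈ χ G w → U^ t ⊳ ψ w ≈ ψ w
  fixes-χ⇒fixes-ψ t w fixes-χ a a-arc = begin
    (U^ t ⊳ ψ w) a                ≡⟨ ⊳-cong (U^ t) (λ b b-arc → sym (trans (U^-one (χ G w) b b-arc) (U-χ w b b-arc))) a ⟩
    (U^ t ⊳ U^ 1 ⊳ χ G w) a       ≡⟨ U^-+ t 1 (χ G w) a a-arc ⟨
    (U^ (t ℕ.+ 1) ⊳ χ G w) a      ≡⟨ cong (λ s → (U^ s ⊳ χ G w) a) (ℕ.+-comm t 1) ⟩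
    (U^ (1 ℕ.+ t) ⊳ χ G w) a      ≡⟨ U^-+ 1 t (χ G w) a a-arc ⟩
    (U^ 1 ⊳ U^ t ⊳ χ G w) a       ≡⟨ ⊳-cong (U^ 1) fixes-χ a ⟩
    (U^ 1 ⊳ χ G w) a              ≡⟨ trans (U^-one (χ G w) a a-arc) (U-χ w a a-arc) ⟩
    ψ w a                         ∎

  periodicity-criterion : ∀ m → (∀ w → U^ (m ℕ.+ m) ⊳ χ G w ≈ χ G w) → IsIdentity G (U^ (m ℕ.+ m))
  periodicity-criterion m fixes-χ = fixes-all⇒identity (U^ (m ℕ.+ m)) fixes-all
    where
    fixes-all : ∀ x → U^ (m ℕ.+ m) ⊳ x ≈ x
    fixes-all x a a-arc = x∙y⁻¹≈ε⇒x≈y ((U^ (m ℕ.+ m) ⊳ x) a) (x a)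
      (InEndpointSpan-⊥⇒≈0 (λ b → (U^ (m ℕ.+ m) ⊳ x) b - x b) (U^[m+m]-sub-id m x)
        (λ w → fixed⊥U^-sub-id (m ℕ.+ m) (χ G w) x (fixes-χ w))
        (λ w → fixed⊥U^-sub-id (m ℕ.+ m) (ψ w) x (fixes-χ⇒fixes-ψ (m ℕ.+ m) w (fixes-χ w)))
        a a-arc)

module SchemeWalk {n d : ℕ} (G : Graph n) (𝒜 : AssocScheme n d) (G∈𝒜 : BelongsTo G 𝒜)
                  (k : ℕ) .⦃ k≢0 : ℕ.NonZero k ⦄ (regular : ∀ w → deg G w ≡ k) where

  open import Data.Rational using (ℚ; 0ℚ; _+_; _*_; -_)
  open GroverWalk G k regular
  open BoseMesner 𝒜
  open Indicators

  EndpointFamily : (Fin n → Vec) → Set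
  EndpointFamily x = Σ[ P ∈ (Fin n → Fin n → ℚ) ] Σ[ Q ∈ (Fin n → Fin n → ℚ) ]
    InSpan P × InSpan Q × (∀ w → x w ≈ endpointVec (λ y → P y w) (λ y → Q y w))

  U^χ-endpointFamily : ∀ t → EndpointFamily (λ w → U^ t ⊳ χ G w)
  U^χ-endpointFamily zero =
    (λ y w → b2ℚ (y == w)) , (λ _ _ → 0ℚ) , InSpan-I , InSpan-0 ,
    λ w a a-arc → trans (idA-⊳ (χ G w) a a-arc) (χ≈endpointVec w a a-arc)
  U^χ-endpointFamily (suc t) with U^χ-endpointFamily t
  ... | P , Q , P∈ , Q∈ , U^tχ≈ =
      (λ y w → - Q y w)
    , (λ y w → P y w + two * (k⁻¹ * adjacencySum (λ z → Q z w) y))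
    , InSpan-neg Q∈
    , InSpan-+ P∈ (InSpan-*ˡ two (InSpan-*ˡ k⁻¹ (InSpan-product (InSpan-adj G G∈𝒜) Q∈)))
    , λ w a a-arc → trans (⊳-assoc (U G) (U^ t) (χ G w) a)
        (U-endpointVec (λ y → P y w) (λ y → Q y w) (U^ t ⊳ χ G w) (U^tχ≈ w) a a-arc)

  ⟪χ,U^χ⟫-InSpan : ∀ t → InSpan (λ y w → ⟪ χ G y , U^ t ⊳ χ G w ⟫)
  ⟪χ,U^χ⟫-InSpan t with U^χ-endpointFamily t
  ... | P , Q , P∈ , Q∈ , U^tχ≈ =
    InSpan-cong (λ y w → trans (⟪χ,⟫ y (U^ t ⊳ χ G w))
                              (inflow-endpointVec (λ y → P y w) (λ y → Q y w) (U^ t ⊳ χ G w) (U^tχ≈ w) y))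
                (InSpan-+ (InSpan-*ˡ kℚ P∈) (InSpan-product (InSpan-adj G G∈𝒜) Q∈))

module PerfectStateTransfer {n d : ℕ} (G : Graph n) (𝒜 : AssocScheme n d) (G∈𝒜 : BelongsTo G 𝒜)
                            (no-isolated : NoIsolated G) (τ : ℕ) {u v : Fin n} (pst : PST G u v τ) where

  open import Data.Nat using (_≤_; _<_; _∸_)
  import Data.Nat.Properties as ℕ
  open import Data.Rational using (ℚ; 0ℚ; 1ℚ; _*_)
  open import Data.Rational.Properties using (*-assoc; *-identityˡ; *-identityʳ; *-zeroʳ; 1≢0)
  open import Data.Rational.Solver using (module +-*-Solver)
  open import Relation.Nullary using (¬_)
  open +-*-Solver
  open import Data.Fin using (_≟_)
  open import Relation.Binary.Definitions using (Tri; tri<; tri≈; tri>)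
  open AssocScheme 𝒜 using (A; A-sym)
  open BoseMesner 𝒜
  open Counting
  open Indicators
  open ≡-Reasoning

  k : ℕ
  k = deg G u

  instance
    k≢0 : ℕ.NonZero k
    k≢0 = ℕ.≢-nonZero (no-isolated u)

  regular : ∀ w → deg G w ≡ k
  regular w = belongsTo⇒regular G G∈𝒜 w u

  open GroverWalk G k regular
  open SchemeWalk G 𝒜 G∈𝒜 k regular

  u≢v : u ≢ v
  u≢v = proj₁ pst

  c : ℚ
  c = proj₁ (proj₂ pst)

  c²deg-v≡deg-u : c * c * fromℕ (deg G v) ≡ fromℕ (deg G u)
  c²deg-v≡deg-u = proj₁ (proj₂ (proj₂ pst))

  transfer : U^ τ ⊳ χ G u ≈ λ a → c * χ G v a
  transfer = proj₂ (proj₂ (proj₂ pst))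

  c²k≡k : c * c * kℚ ≡ kℚ
  c²k≡k = subst (λ m → c * c * fromℕ m ≡ kℚ) (regular v) c²deg-v≡deg-u

  c²≡1 : c * c ≡ 1ℚ
  c²≡1 = begin
    c * c                   ≡⟨ *-identityʳ (c * c) ⟨
    c * c * 1ℚ              ≡⟨ cong (c * c *_) k⁻¹*k≡1 ⟨
    c * c * (k⁻¹ * kℚ)      ≡⟨ solve 3 (λ c r k → c :* c :* (r :* k) := r :* (c :* c :* k)) refl c k⁻¹ kℚ ⟩
    k⁻¹ * (c * c * kℚ)      ≡⟨ cong (k⁻¹ *_) c²k≡k ⟩
    k⁻¹ * kℚ                ≡⟨ k⁻¹*k≡1 ⟩
    1ℚ                      ∎

  c*c*q≡q : ∀ q → c * (c * q) ≡ q
  c*c*q≡q q = trans (sym (*-assoc c c q)) (trans (cong (_* q) c²≡1) (*-identityˡ q))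

  ck≢0 : c * kℚ ≢ 0ℚ
  ck≢0 ck≡0 = 1≢0 (begin
    1ℚ              ≡⟨ k⁻¹*k≡1 ⟨
    k⁻¹ * kℚ        ≡⟨ cong (k⁻¹ *_) (c*c*q≡q kℚ) ⟨
    k⁻¹ * (c * (c * kℚ))  ≡⟨ cong (λ e → k⁻¹ * (c * e)) ck≡0 ⟩
    k⁻¹ * (c * 0ℚ)  ≡⟨ cong (k⁻¹ *_) (*-zeroʳ c) ⟩
    k⁻¹ * 0ℚ        ≡⟨ *-zeroʳ k⁻¹ ⟩
    0ℚ              ∎)

  M : Fin n → Fin n → ℚ
  M y w = ⟪ χ G y , U^ τ ⊳ χ G w ⟫

  m : Fin (suc d) → ℚ
  m = proj₁ (⟪χ,U^χ⟫-InSpan τ)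

  M≡m : ∀ y w → M y w ≡ m (cls y w)
  M≡m = proj₂ (⟪χ,U^χ⟫-InSpan τ)

  M-column-u : ∀ y → M y u ≡ c * (kℚ * b2ℚ (y == v))
  M-column-u y = begin
    ⟪ χ G y , U^ τ ⊳ χ G u ⟫           ≡⟨ ⟪⟫-congʳ (χ G y) transfer ⟩
    ⟪ χ G y , (λ a → c * χ G v a) ⟫    ≡⟨ ⟪⟫-*ʳ c (χ G y) (χ G v) ⟩
    c * ⟪ χ G y , χ G v ⟫              ≡⟨ cong (c *_) (⟪χ,χ⟫ y v) ⟩
    c * (kℚ * b2ℚ (y == v))            ∎

  i : Fin (suc d)
  i = cls v u

  m-i : m i ≡ c * kℚ
  m-i = begin
    m (cls v u)               ≡⟨ M≡m v u ⟨
    M v u                     ≡⟨ M-column-u v ⟩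
    c * (kℚ * b2ℚ (v == v))   ≡⟨ cong (λ b → c * (kℚ * b2ℚ b)) (==-refl v) ⟩
    c * (kℚ * 1ℚ)             ≡⟨ cong (c *_) (*-identityʳ kℚ) ⟩
    c * kℚ                    ∎

  -- Column u of M is c k e_v, while M is constant, equal to c k ≢ 0, on the class i.
  A-i-row-u : ∀ y → A i u y ≡ (y == v)
  A-i-row-u y with A i u y in A-iuy
  ... | true  = sym (==-true y≡v)
    where
    y≡v : y ≡ v
    y≡v with y ≟ v
    ... | yes y≡v = y≡v
    ... | no y≢v  = ⊥-elim (ck≢0 (begin
      c * kℚ                   ≡⟨ m-i ⟨
      m i                      ≡⟨ cong m (cls-unique i y u (trans (A-sym i y u) A-iuy)) ⟩
      m (cls y u)              ≡⟨ M≡m y u ⟨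
      M y u                    ≡⟨ M-column-u y ⟩
      c * (kℚ * b2ℚ (y == v))  ≡⟨ cong (λ b → c * (kℚ * b2ℚ b)) (==-false y≢v) ⟩
      c * (kℚ * 0ℚ)            ≡⟨ cong (c *_) (*-zeroʳ kℚ) ⟩
      c * 0ℚ                   ≡⟨ *-zeroʳ c ⟩
      0ℚ                       ∎))
  ... | false = sym (==-false y≢v)
    where
    y≢v : y ≢ v
    y≢v refl with () ← trans (sym A-iuy) (trans (A-sym i u y) (A-cls y u))

  open ValencyOne i u (count-singleton n (A i u) v A-i-row-u)

  M-partner : ∀ w → M (partner w) w ≡ c * kℚ
  M-partner w = begin
    M (partner w) w            ≡⟨ M≡m (partner w) w ⟩
    m (cls (partner w) w)      ≡⟨ cong m (cls-unique i (partner w) w (trans (A-sym i (partner w) w) (A-partner w))) ⟨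
    m i                        ≡⟨ m-i ⟩
    c * kℚ                     ∎

  -- Both vectors have squared norm k and their inner product is k.
  U^τχ≈cχ-partner : ∀ w → U^ τ ⊳ χ G w ≈ λ a → c * χ G (partner w) a
  U^τχ≈cχ-partner w = ≈-by-inner (U^ τ ⊳ χ G w) (λ a → c * χ G (partner w) a) (trans ‖x‖²≡k (sym ‖y‖²≡k)) (trans ⟪y,x⟫≡k (sym ‖y‖²≡k))
    where
    ‖χ‖²≡k : ∀ w → ⟪ χ G w , χ G w ⟫ ≡ kℚ
    ‖χ‖²≡k w = trans (⟪χ,χ⟫ w w) (trans (cong (λ b → kℚ * b2ℚ b) (==-refl w)) (*-identityʳ kℚ))
    ‖x‖²≡k : ⟪ U^ τ ⊳ χ G w , U^ τ ⊳ χ G w ⟫ ≡ kℚ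
    ‖x‖²≡k = trans (U^-orthogonal τ (χ G w) (χ G w)) (‖χ‖²≡k w)
    ‖y‖²≡k : ⟪ (λ a → c * χ G (partner w) a) , (λ a → c * χ G (partner w) a) ⟫ ≡ kℚ
    ‖y‖²≡k = begin
      ⟪ (λ a → c * χ G (partner w) a) , (λ a → c * χ G (partner w) a) ⟫  ≡⟨ ⟪⟫-*ˡ c (χ G (partner w)) (λ a → c * χ G (partner w) a) ⟩
      c * ⟪ χ G (partner w) , (λ a → c * χ G (partner w) a) ⟫            ≡⟨ cong (c *_) (⟪⟫-*ʳ c (χ G (partner w)) (χ G (partner w))) ⟩
      c * (c * ⟪ χ G (partner w) , χ G (partner w) ⟫)                    ≡⟨ c*c*q≡q ⟪ χ G (partner w) , χ G (partner w) ⟫ ⟩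
      ⟪ χ G (partner w) , χ G (partner w) ⟫                              ≡⟨ ‖χ‖²≡k (partner w) ⟩
      kℚ                                                                 ∎
    ⟪y,x⟫≡k : ⟪ (λ a → c * χ G (partner w) a) , U^ τ ⊳ χ G w ⟫ ≡ kℚ
    ⟪y,x⟫≡k = begin
      ⟪ (λ a → c * χ G (partner w) a) , U^ τ ⊳ χ G w ⟫   ≡⟨ ⟪⟫-*ˡ c (χ G (partner w)) (U^ τ ⊳ χ G w) ⟩
      c * M (partner w) w                                ≡⟨ cong (c *_) (M-partner w) ⟩
      c * (c * kℚ)                                       ≡⟨ c*c*q≡q kℚ ⟩
      kℚ                                                 ∎

  U^[τ+τ]χ≈χ : ∀ w → U^ (τ ℕ.+ τ) ⊳ χ G w ≈ χ G w
  U^[τ+τ]χ≈χ w a a-arc = begin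
    (U^ (τ ℕ.+ τ) ⊳ χ G w) a                  ≡⟨ U^-+ τ τ (χ G w) a a-arc ⟩
    (U^ τ ⊳ U^ τ ⊳ χ G w) a                   ≡⟨ ⊳-cong (U^ τ) (U^τχ≈cχ-partner w) a ⟩
    (U^ τ ⊳ (λ b → c * χ G (partner w) b)) a  ≡⟨ ⊳-*ˡ (U^ τ) c (χ G (partner w)) a ⟩
    c * (U^ τ ⊳ χ G (partner w)) a            ≡⟨ cong (c *_) (U^τχ≈cχ-partner (partner w) a a-arc) ⟩
    c * (c * χ G (partner (partner w)) a)     ≡⟨ c*c*q≡q (χ G (partner (partner w)) a) ⟩
    χ G (partner (partner w)) a               ≡⟨ cong (λ y → χ G y a) (partner-involutive w) ⟩
    χ G w a                                   ∎

  U^[τ+τ]≡I : IsIdentity G (U^ (τ ℕ.+ τ))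
  U^[τ+τ]≡I = periodicity-criterion τ U^[τ+τ]χ≈χ

  identity⇒earlier-transfer : ∀ t → t < τ → IsIdentity G (U^ t) → U^ (τ ∸ t) ⊳ χ G u ≈ λ a → c * χ G v a
  identity⇒earlier-transfer t t<τ U^t≡I a a-arc = begin
    (U^ (τ ∸ t) ⊳ χ G u) a          ≡⟨ ⊳-cong (U^ (τ ∸ t)) (λ b b-arc → sym (identity-⊳ (U^ t) U^t≡I (χ G u) b b-arc)) a ⟩
    (U^ (τ ∸ t) ⊳ U^ t ⊳ χ G u) a   ≡⟨ U^-+ (τ ∸ t) t (χ G u) a a-arc ⟨
    (U^ (τ ∸ t ℕ.+ t) ⊳ χ G u) a    ≡⟨ cong (λ s → (U^ s ⊳ χ G u) a) (ℕ.m∸n+n≡m (ℕ.<⇒≤ t<τ)) ⟩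
    (U^ τ ⊳ χ G u) a                ≡⟨ transfer a a-arc ⟩
    c * χ G v a                     ∎

  U^τ≢I : ¬ IsIdentity G (U^ τ)
  U^τ≢I U^τ≡I = 1≢0 (begin
    1ℚ                        ≡⟨ cong b2ℚ (==-refl u) ⟨
    b2ℚ (u == u)              ≡⟨ χ-on-arcs u (y , u) yu-arc ⟨
    χ G u (y , u)             ≡⟨ identity-⊳ (U^ τ) U^τ≡I (χ G u) (y , u) yu-arc ⟨
    (U^ τ ⊳ χ G u) (y , u)    ≡⟨ transfer (y , u) yu-arc ⟩
    c * χ G v (y , u)         ≡⟨ cong (c *_) (χ-on-arcs v (y , u) yu-arc) ⟩
    c * b2ℚ (u == v)          ≡⟨ cong (λ b → c * b2ℚ b) (==-false u≢v) ⟩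
    c * 0ℚ                    ≡⟨ *-zeroʳ c ⟩
    0ℚ                        ∎)
    where
    neighbour : Σ[ y ∈ Fin n ] Graph.adj G u y ≡ true
    neighbour = count-nonzero n (Graph.adj G u) (no-isolated u)
    y : Fin n
    y = proj₁ neighbour
    yu-arc : IsArc G (y , u)
    yu-arc = subst T (sym (trans (Graph.symmetric G y u) (proj₂ neighbour))) _

  identity⇒transfer-back : ∀ t → τ < t → IsIdentity G (U^ t) → U^ (t ∸ τ) ⊳ χ G v ≈ λ a → c * χ G u a
  identity⇒transfer-back t τ<t U^t≡I a a-arc = begin
    (U^ (t ∸ τ) ⊳ χ G v) a               ≡⟨ c*c*q≡q ((U^ (t ∸ τ) ⊳ χ G v) a) ⟨
    c * (c * (U^ (t ∸ τ) ⊳ χ G v) a)     ≡⟨ cong (c *_) χu≈cU^χv ⟨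
    c * χ G u a                          ∎
    where
    χu≈cU^χv : χ G u a ≡ c * (U^ (t ∸ τ) ⊳ χ G v) a
    χu≈cU^χv = begin
      χ G u a                                  ≡⟨ identity-⊳ (U^ t) U^t≡I (χ G u) a a-arc ⟨
      (U^ t ⊳ χ G u) a                         ≡⟨ cong (λ s → (U^ s ⊳ χ G u) a) (ℕ.m∸n+n≡m (ℕ.<⇒≤ τ<t)) ⟨
      (U^ (t ∸ τ ℕ.+ τ) ⊳ χ G u) a             ≡⟨ U^-+ (t ∸ τ) τ (χ G u) a a-arc ⟩
      (U^ (t ∸ τ) ⊳ U^ τ ⊳ χ G u) a            ≡⟨ ⊳-cong (U^ (t ∸ τ)) transfer a ⟩
      (U^ (t ∸ τ) ⊳ (λ b → c * χ G v b)) a     ≡⟨ ⊳-*ˡ (U^ (t ∸ τ)) c (χ G v) a ⟩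
      c * (U^ (t ∸ τ) ⊳ χ G v) a               ∎

  no-period-below-τ+τ : (∀ τ' → 1 ≤ τ' → τ' < τ → ¬ HasPSTAt G τ') →
                       ∀ t → 1 ≤ t → t < τ ℕ.+ τ → ¬ IsIdentity G (U^ t)
  no-period-below-τ+τ minimal t 1≤t t<τ+τ U^t≡I = by-cases (ℕ.<-cmp t τ)
    where
    by-cases : Tri (t < τ) (t ≡ τ) (τ < t) → ⊥
    by-cases (tri< t<τ _ _) =
      minimal (τ ∸ t) (ℕ.m<n⇒0<n∸m t<τ) (ℕ.∸-monoʳ-< {τ} {t} {0} 1≤t (ℕ.<⇒≤ t<τ))
        (u , v , u≢v , c , c²deg-v≡deg-u , identity⇒earlier-transfer t t<τ U^t≡I)
    by-cases (tri≈ _ t≡τ _) = U^τ≢I (subst (λ s → IsIdentity G (U^ s)) t≡τ U^t≡I)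
    by-cases (tri> _ _ τ<t) =
      minimal (t ∸ τ) (ℕ.m<n⇒0<n∸m τ<t) (subst (t ∸ τ <_) (ℕ.m+n∸n≡m τ τ) (ℕ.∸-monoˡ-< t<τ+τ (ℕ.<⇒≤ τ<t)))
        (v , u , u≢v ∘ sym , c , trans c²k≡k (cong fromℕ (sym (regular v))) , identity⇒transfer-back t τ<t U^t≡I)

open import Data.Nat using (ℕ; _≤_; _<_; _*_; _+_)
import Data.Nat.Properties as ℕ
open import Relation.Nullary using (¬_)

lemma3p5 : ∀ {n d : ℕ} (G : Graph n) (𝒜 : AssocScheme n d) →
    NoIsolated G → BelongsTo G 𝒜 →
    (τ : ℕ) → 1 ≤ τ → HasPSTAt G τ →
    (∀ τ' → 1 ≤ τ' → τ' < τ → ¬ HasPSTAt G τ') →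
    Periodic G (2 * τ)
lemma3p5 G 𝒜 no-isolated G∈𝒜 τ 1≤τ (u , v , pst) minimal =
    subst (1 ≤_) τ+τ≡2τ (ℕ.≤-trans 1≤τ (ℕ.m≤m+n τ τ))
  , subst (λ t → IsIdentity G (_^_ G (U G) t)) τ+τ≡2τ U^[τ+τ]≡I
  , λ t 1≤t t<2τ → no-period-below-τ+τ minimal t 1≤t (subst (t <_) (sym τ+τ≡2τ) t<2τ)
  where
  open PerfectStateTransfer G 𝒜 G∈𝒜 no-isolated τ pst
  τ+τ≡2τ : τ + τ ≡ 2 * τ
  τ+τ≡2τ = cong (τ +_) (sym (ℕ.+-identityʳ τ))
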